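{- Let $n\ge 4$ and $s$ be integers with $2 \leq s \leq \lfloor\frac{n}{2}\rfloor$, and let $S_{n,s}$ be the spire graph. Then $$rn(S_{n,s}) \geq \begin{cases} 2k^2 -4k + 2s +3 & \text{if } n = 2k \text{ and } 2 \leq s \leq k-2,\\ 2k^2 -2k & \text{if } n = 2k \text{ and } s= k-1,\\ 2k^2 -2k + 1 & \text{if } n = 2k \text{ and } s= k,\\ 2k^2 -2k + 2s & \text{if } n = 2k + 1. \end{cases}$$
   Context: For a connected graph $G$, $d(u,v)$ denotes the graph distance and $\mathrm{diam}(G)$ the diameter. A radio labeling of $G$ is a function $c:V(G)\to\mathbb{Z}_{+}$ (positive integers; $0$ is not allowed) such that for all distinct $u,v\in V(G)$, $d(u,v)+|c(u)-c(v)|\ge \mathrm{diam}(G)+1$. The span of $c$ is the maximum value of $c$, and the radio number $rn(G)$ is the minimum span over all radio labelings of $G$. For integers $n\ge 4$ and $2\le s\le n-2$, the spire graph $S_{n,s}$ has vertices $v_1,\dots,v_n$ and edges $\{v_i,v_{i+1}\}$ for $i=1,\dots,n-2$ together with the edge $\{v_s,v_n\}$. -}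

module Defs where

open import Data.Nat using (ℕ; zero; suc; _+_; _*_; _∸_; _≤_; _⊔_; ∣_-_∣)
open import Data.Fin using (Fin; toℕ)
open import Data.List using (foldr; map; allFin)
open import Data.Product using (_×_; ∃; ∃-syntax; _,_)
open import Data.Sum using (_⊎_)
open import Relation.Binary.PropositionalEquality using (_≡_; _≢_)

-- Vertex x : Fin n represents v_i with i = suc (toℕ x)  (1-based label).
label : ∀ {n} → Fin n → ℕ
label x = suc (toℕ x)

SpireEdge : ℕ → ℕ → ℕ → ℕ → Set
SpireEdge n s i j = (j ≡ suc i × j ≤ n ∸ 1) ⊎ (i ≡ s × j ≡ n)

SpireAdj : (n s : ℕ) → Fin n → Fin n → Set
SpireAdj n s u v = SpireEdge n s (label u) (label v) ⊎ SpireEdge n s (label v) (label u)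

data Walk {n : ℕ} (Adj : Fin n → Fin n → Set) : Fin n → Fin n → ℕ → Set where
  here : ∀ {u} → Walk Adj u u zero
  step : ∀ {u v w k} → Adj u v → Walk Adj v w k → Walk Adj u w (suc k)

Dist : ∀ {n} → (Fin n → Fin n → Set) → Fin n → Fin n → ℕ → Set
Dist Adj u v k = Walk Adj u v k × (∀ m → Walk Adj u v m → k ≤ m)

IsDiameter : ∀ {n} → (Fin n → Fin n → Set) → ℕ → Set
IsDiameter {n} Adj D =
  (∀ u v k → Dist Adj u v k → k ≤ D) × (∃[ u ] ∃[ v ] Dist Adj u v D)

IsRadioLabeling : ∀ {n} → (Fin n → Fin n → Set) → ℕ → (Fin n → ℕ) → Set
IsRadioLabeling {n} Adj D c =
  (∀ v → 1 ≤ c v) ×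
  (∀ u v → u ≢ v → ∀ k → Dist Adj u v k → suc D ≤ k + ∣ c u - c v ∣)

span : ∀ {n} → (Fin n → ℕ) → ℕ
span {n} c = foldr _⊔_ 0 (map c (allFin n))

-- Sort the vertices by label, x₀, x₁, …, x_{n−1}. Since diam ≥ n − 2, the radio condition gives
-- c(x_{i+1}) ≥ c(x_i) + (n − 1) − d(x_i, x_{i+1}), and likewise with x_{i+2} for x_{i+1}, so the span
-- is at least 1 plus the cost of any chain through the sorted list advancing one or two places at a
-- time. A level ℓ, the distance to a centre of the path, satisfies d(u, v) ≤ ℓ u + ℓ v; summed along
-- a chain this bounds the span from below by 1 + (n − 1)·A − 2Σℓ plus a surplus, where A is the demand
-- per step, and Σℓ has a closed form. What remains is a surplus of 1 or 2.
--  * n odd, or s = n/2: one centre, A = n − 1, and the two ends of the order are not both the centre.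
--  * n even, s ≤ n/2 − 1: centres n/2 and n/2 + 1, A = n − 2; consecutive vertices on the same side
--    of the middle earn an extra unit, and if the order alternates sides the chain jumps over the
--    far vertex v_{n−1}, whose level makes up for the skipped step.
--  * s ≤ n/2 − 2: each side has n/2 vertices, which forces a second unit from the ends or from
--    same-side pairs, unless the order alternates; then jumps over v_{n−1} and v_{n−2} supply it.

module Submission where

open import Data.Bool using (Bool; true; false; not; _∧_; _∨_; if_then_else_)
open import Data.Empty using (⊥; ⊥-elim)
open import Data.Fin using (Fin; toℕ; fromℕ<) renaming (zero to fzero)
open import Data.Fin.Properties using (toℕ-injective; toℕ<n; toℕ-fromℕ<) renaming (_≟_ to _≟ᶠ_)
open import Data.List using (List; []; _∷_; _++_; length; map; foldr; tabulate; allFin)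
open import Data.List.Membership.Propositional using (_∈_)
open import Data.List.Membership.Propositional.Properties using (∈-∃++; ∈-++⁺ˡ; ∈-++⁺ʳ; ∈-++⁻; ∈-allFin)
open import Data.List.Properties using (length-++; length-tabulate; map-tabulate)
open import Data.List.Relation.Binary.Permutation.Propositional using (_↭_; ↭-sym; ↭⇒↭ₛ)
open import Data.List.Relation.Binary.Permutation.Propositional.Properties using (∈-resp-↭; ↭-length; map⁺)
import Data.List.Relation.Binary.Permutation.Setoid.Properties as Perm
open import Data.List.Relation.Unary.All as All using (All; _∷_)
import Data.List.Relation.Unary.All.Properties as All
open import Data.List.Relation.Unary.AllPairs as AllPairs using (AllPairs; []; _∷_)
open import Data.List.Relation.Unary.Any using (here; there)
open import Data.List.Relation.Unary.Sorted.TotalOrder.Properties using (Sorted⇒AllPairs)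
open import Data.List.Relation.Unary.Unique.Propositional using (Unique)
open import Data.List.Relation.Unary.Unique.Propositional.Properties using (allFin⁺)
import Data.List.Sort as Sort
open import Data.Nat
open import Data.Nat.DivMod using (_/_; m/n*n≤m)
open import Data.Nat.ListAction using (sum)
open import Data.Nat.ListAction.Properties using (sum-↭)
open import Data.Nat.Properties
open import Algebra.Properties.CommutativeSemigroup +-commutativeSemigroup using (interchange)
open import Data.Nat.Tactic.RingSolver using (solve-∀)
open import Data.Product using (Σ; ∃; ∃₂; _×_; _,_; proj₁; proj₂)
open import Data.Sum using (_⊎_; inj₁; inj₂)
open import Function using (_∘_; id)
open import Relation.Binary.Bundles using (DecTotalOrder)
import Relation.Binary.Construct.On as On
open import Relation.Binary.Definitions using (DecidableEquality)
open import Relation.Binary.PropositionalEquality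
open import Relation.Nullary using (Dec; yes; no)
open import Defs

sumTo : (ℕ → ℕ) → ℕ → ℕ
sumTo f zero    = 0
sumTo f (suc n) = f 1 + sumTo (f ∘ suc) n

sumTo-snoc : ∀ f n → sumTo f (suc n) ≡ sumTo f n + f (suc n)
sumTo-snoc f zero    = +-comm (f 1) 0
sumTo-snoc f (suc n) = trans (cong (f 1 +_) (sumTo-snoc (f ∘ suc) n)) (sym (+-assoc (f 1) _ _))

sumTo-cong : ∀ {f g} n → (∀ i → 1 ≤ i → i ≤ n → f i ≡ g i) → sumTo f n ≡ sumTo g n
sumTo-cong zero    f≗g = refl
sumTo-cong (suc n) f≗g =
  cong₂ _+_ (f≗g 1 ≤-refl (s≤s z≤n)) (sumTo-cong n (λ i 1≤i i≤n → f≗g (suc i) (m≤n⇒m≤1+n 1≤i) (s≤s i≤n)))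

sumTo-+ : ∀ f g n → sumTo (λ i → f i + g i) n ≡ sumTo f n + sumTo g n
sumTo-+ f g zero    = refl
sumTo-+ f g (suc n) = begin
  f 1 + g 1 + sumTo (λ i → f (suc i) + g (suc i)) n     ≡⟨ cong (f 1 + g 1 +_) (sumTo-+ (f ∘ suc) (g ∘ suc) n) ⟩
  f 1 + g 1 + (sumTo (f ∘ suc) n + sumTo (g ∘ suc) n)   ≡⟨ interchange (f 1) (g 1) _ _ ⟩
  f 1 + sumTo (f ∘ suc) n + (g 1 + sumTo (g ∘ suc) n)   ∎
  where open ≡-Reasoning

sumTo-const : ∀ a n → sumTo (λ _ → a) n ≡ n * a
sumTo-const a zero    = refl
sumTo-const a (suc n) = cong (a +_) (sumTo-const a n)

sumTo-zero : ∀ {f} n → (∀ i → 1 ≤ i → i ≤ n → f i ≡ 0) → sumTo f n ≡ 0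
sumTo-zero n f≗0 = trans (sumTo-cong n f≗0) (trans (sumTo-const 0 n) (*-zeroʳ n))

double-sumTo-∸ˡ : ∀ c r → 2 * sumTo (c ∸_) (c + r) + c ≡ c * c
double-sumTo-∸ˡ zero    r = cong (λ t → 2 * t + 0) (sumTo-zero r (λ i _ _ → 0∸n≡0 i))
double-sumTo-∸ˡ (suc c) r = begin
  2 * (c + X) + suc c   ≡⟨ regroup c X ⟩
  2 * X + c + (2 * c + 1) ≡⟨ cong (_+ (2 * c + 1)) (double-sumTo-∸ˡ c r) ⟩
  c * c + (2 * c + 1)   ≡⟨ square-suc c ⟩
  suc c * suc c         ∎
  where
    open ≡-Reasoning
    X : ℕ
    X = sumTo (c ∸_) (c + r)
    regroup : ∀ c X → 2 * (c + X) + suc c ≡ 2 * X + c + (2 * c + 1)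
    regroup = solve-∀
    square-suc : ∀ c → c * c + (2 * c + 1) ≡ suc c * suc c
    square-suc = solve-∀

double-sumTo-id : ∀ r → 2 * sumTo id r ≡ r * suc r
double-sumTo-id zero    = refl
double-sumTo-id (suc r) = begin
  2 * sumTo id (suc r)            ≡⟨ cong (2 *_) (sumTo-snoc id r) ⟩
  2 * (sumTo id r + suc r)        ≡⟨ *-distribˡ-+ 2 (sumTo id r) (suc r) ⟩
  2 * sumTo id r + 2 * suc r      ≡⟨ cong (_+ 2 * suc r) (double-sumTo-id r) ⟩
  r * suc r + 2 * suc r           ≡⟨ regroup r ⟩
  suc r * suc (suc r)             ∎
  where
    open ≡-Reasoning
    regroup : ∀ r → r * suc r + 2 * suc r ≡ suc r * suc (suc r)
    regroup = solve-∀

double-sumTo-∸ʳ : ∀ c r → 2 * sumTo (_∸ c) (c + r) ≡ r * suc r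
double-sumTo-∸ʳ zero    r = double-sumTo-id r
double-sumTo-∸ʳ (suc c) r = trans (cong (λ t → 2 * (t + sumTo (_∸ c) (c + r))) (0∸n≡0 c)) (double-sumTo-∸ʳ c r)

indicator : Bool → ℕ
indicator b = if b then 1 else 0

sumTo-<ᵇ : ∀ c r → sumTo (λ i → indicator (i <ᵇ suc c)) (c + r) ≡ c
sumTo-<ᵇ zero    zero    = refl
sumTo-<ᵇ zero    (suc r) = sumTo-zero r (λ { (suc i) _ _ → refl })
sumTo-<ᵇ (suc c) r       = cong suc (sumTo-<ᵇ c r)

sum-labels : ∀ n g → sum (map (g ∘ label) (allFin n)) ≡ sumTo g n
sum-labels n g = trans (cong sum (map-tabulate {n = n} id (g ∘ label))) (sum-tabulate n g)
  where
    sum-tabulate : ∀ n g → sum (tabulate {n = n} (g ∘ label)) ≡ sumTo g n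
    sum-tabulate zero    g = refl
    sum-tabulate (suc n) g = cong (g 1 +_) (sum-tabulate n (g ∘ suc))

≤-rebalance : ∀ {a b x y} → x ≤ y → a + y ≡ b + x → a ≤ b
≤-rebalance {a} {b} {x} x≤y eq = +-cancelʳ-≤ x a b (≤-trans (+-monoʳ-≤ a x≤y) (≤-reflexive eq))

cancel-by : ∀ {P Q X Y : ℕ} → P ≡ Q → X + Q ≡ Y + P → X ≡ Y
cancel-by {P} {Q} {X} {Y} P≡Q eq = +-cancelʳ-≡ Q X Y (trans eq (cong (Y +_) P≡Q))

≤-middle : ∀ {g G} G₁ G₂ → g ≤ G → g ≤ G₁ + (G + G₂)
≤-middle {g} {G} G₁ G₂ g≤G = ≤-trans (≤-trans g≤G (m≤m+n G G₂)) (m≤n+m _ G₁)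

skip-gain : ∀ {A X t} e f → A + e ≤ X → A + f ≤ e + t → A + A + f ≤ X + t
skip-gain {A} {X} {t} e f h₁ h₂ = ≤-rebalance (+-mono-≤ h₁ h₂) (regroup A e f X t)
  where
    regroup : ∀ A e f X t → A + A + f + (X + (e + t)) ≡ X + t + (A + e + (A + f))
    regroup = solve-∀

agree : Bool → Bool → ℕ
agree b c = indicator (b ∧ c) + indicator (not (b ∨ c))

agree-false : ∀ {b} → agree b false ≡ 0 → b ≡ true
agree-false {true} _ = refl

false-agree : ∀ {b} → agree false b ≡ 0 → b ≡ true
false-agree {true} _ = refl

indicator-not : ∀ b → indicator b + indicator (not b) ≡ 1
indicator-not true  = refl
indicator-not false = refl

indicator-balance : ∀ b c → indicator (b ∧ c) + indicator (not b) ≡ indicator (not (b ∨ c)) + indicator c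
indicator-balance true  true  = refl
indicator-balance true  false = refl
indicator-balance false true  = refl
indicator-balance false false = refl

pairs-balance-step : ∀ bx by T CF L F CT → T + CF + indicator by + L ≡ F + CT + 1 →
  indicator (bx ∧ by) + T + (indicator (not bx) + CF) + indicator bx + L ≡ indicator (not (bx ∨ by)) + F + (indicator bx + CT) + 1
pairs-balance-step bx by T CF L F CT ih = cancel-by ih (begin
  a + T + (b + CF) + x + L + (F + CT + 1)   ≡⟨ collect a b T CF x L F CT ⟩
  a + b + R                                 ≡⟨ cong (_+ R) (indicator-balance bx by) ⟩
  d + y + R                                 ≡⟨ spread d y T CF x L F CT ⟩
  d + F + (x + CT) + 1 + (T + CF + y + L)   ∎)
  where
    open ≡-Reasoning
    a b d x y R : ℕ
    a = indicator (bx ∧ by)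
    b = indicator (not bx)
    d = indicator (not (bx ∨ by))
    x = indicator bx
    y = indicator by
    R = T + CF + x + L + (F + CT + 1)
    collect : ∀ a b T CF x L F CT → a + T + (b + CF) + x + L + (F + CT + 1) ≡ a + b + (T + CF + x + L + (F + CT + 1))
    collect = solve-∀
    spread : ∀ d y T CF x L F CT → d + y + (T + CF + x + L + (F + CT + 1)) ≡ d + F + (x + CT) + 1 + (T + CF + y + L)
    spread = solve-∀

-- Chains through an enumeration

module _ {V : Set} where

  lastOf : V → List V → V
  lastOf x []       = x
  lastOf x (y ∷ ys) = lastOf y ys

  lastOf-++ : ∀ x ys zs → lastOf x (ys ++ zs) ≡ lastOf (lastOf x ys) zs
  lastOf-++ x []       zs = refl
  lastOf-++ x (y ∷ ys) zs = lastOf-++ y ys zs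

  lastOf-∈ : ∀ x ys → lastOf x ys ∈ x ∷ ys
  lastOf-∈ x []       = here refl
  lastOf-∈ x (y ∷ ys) = there (lastOf-∈ y ys)

  lastOf-∈-suffix : ∀ x p z zs → lastOf x (p ++ z ∷ zs) ∈ z ∷ zs
  lastOf-∈-suffix x p z zs = subst (_∈ z ∷ zs) (sym (lastOf-++ x p (z ∷ zs))) (lastOf-∈ z zs)

  Unique-++ˡ : ∀ xs {ys : List V} → Unique (xs ++ ys) → Unique xs
  Unique-++ˡ []       _        = []
  Unique-++ˡ (x ∷ xs) (x∉ ∷ u) = All.++⁻ˡ xs x∉ ∷ Unique-++ˡ xs u

  Unique-++ʳ : ∀ xs {ys : List V} → Unique (xs ++ ys) → Unique ys
  Unique-++ʳ []       u       = u
  Unique-++ʳ (x ∷ xs) (_ ∷ u) = Unique-++ʳ xs u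

  Unique-head : ∀ {x v : V} {ys} → Unique (x ∷ ys) → v ∈ ys → x ≢ v
  Unique-head (x∉ ∷ _) v∈ = All.lookup x∉ v∈

  Unique-++-disjoint : ∀ xs {ys : List V} {u v} → Unique (xs ++ ys) → u ∈ xs → v ∈ ys → u ≢ v
  Unique-++-disjoint (x ∷ xs) (x∉ ∷ _) (here refl) v∈ = All.lookup x∉ (∈-++⁺ʳ xs v∈)
  Unique-++-disjoint (x ∷ xs) (_ ∷ u)  (there u∈)  v∈ = Unique-++-disjoint xs u u∈ v∈

  data Placement (v x : V) : List V → Set where
    first  : ∀ {ys} → x ≡ v → Placement v x ys
    final  : ∀ {ys} → lastOf x ys ≡ v → Placement v x ys
    middle : ∀ p b q → Placement v x (p ++ v ∷ b ∷ q)

  placement : ∀ {v x ys} → v ∈ x ∷ ys → Placement v x ys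
  placement (here x≡v) = first (sym x≡v)
  placement {v} {x} (there v∈) with ∈-∃++ v∈
  ... | p , []    , refl = final (lastOf-++ x p (v ∷ []))
  ... | p , b ∷ q , refl = middle p b q

  alongPairs : (V → V → ℕ) → V → List V → ℕ
  alongPairs f x []       = 0
  alongPairs f x (y ∷ ys) = f x y + alongPairs f y ys

  alongPairs-++ : ∀ f x ys zs → alongPairs f x (ys ++ zs) ≡ alongPairs f x ys + alongPairs f (lastOf x ys) zs
  alongPairs-++ f x []       zs = refl
  alongPairs-++ f x (y ∷ ys) zs = trans (cong (f x y +_) (alongPairs-++ f y ys zs)) (sym (+-assoc (f x y) _ _))

  alongPairs-+ : ∀ f g x ys → alongPairs (λ u v → f u v + g u v) x ys ≡ alongPairs f x ys + alongPairs g x ys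
  alongPairs-+ f g x []       = refl
  alongPairs-+ f g x (y ∷ ys) = trans (cong (f x y + g x y +_) (alongPairs-+ f g y ys)) (interchange (f x y) (g x y) _ _)

module _ {V : Set} (cost : V → V → ℕ) where

  data Chain : V → List V → ℕ → Set where
    []   : ∀ {x} → Chain x [] 0
    step : ∀ {x y ys m} → Chain y ys m → Chain x (y ∷ ys) (cost x y + m)
    skip : ∀ {x y z ys m} → Chain z ys m → Chain x (y ∷ z ∷ ys) (cost x z + m)

  chain-++ : ∀ {x ys zs m₁ m₂} → Chain x ys m₁ → Chain (lastOf x ys) zs m₂ → Chain x (ys ++ zs) (m₁ + m₂)
  chain-++         []                          ch₂ = ch₂
  chain-++ {x}     (step {y = y} {m = m} ch₁)  ch₂ = subst (Chain x _) (sym (+-assoc (cost x y) m _)) (step (chain-++ ch₁ ch₂))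
  chain-++ {x}     (skip {z = z} {m = m} ch₁)  ch₂ = subst (Chain x _) (sym (+-assoc (cost x z) m _)) (skip (chain-++ ch₁ ch₂))

  module _ (c : V → ℕ) (cost-≤ : ∀ {u v} → u ≢ v → c u ≤ c v → c u + cost u v ≤ c v) where

    chain-≤ : ∀ {x ys m} → Chain x ys m → AllPairs (λ a b → c a ≤ c b) (x ∷ ys) → Unique (x ∷ ys) →
              c x + m ≤ c (lastOf x ys)
    chain-≤ [] _ _ = ≤-reflexive (+-identityʳ _)
    chain-≤ {x} (step {y = y} {ys} {m} ch) ((x≤y ∷ _) ∷ sorted) ((x≢y ∷ _) ∷ unique) = begin
      c x + (cost x y + m)  ≡⟨ +-assoc (c x) (cost x y) m ⟨
      c x + cost x y + m    ≤⟨ +-monoˡ-≤ m (cost-≤ x≢y x≤y) ⟩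
      c y + m               ≤⟨ chain-≤ ch sorted unique ⟩
      c (lastOf y ys)       ∎
      where open ≤-Reasoning
    chain-≤ {x} (skip {z = z} {ys} {m} ch) ((_ ∷ x≤z ∷ _) ∷ _ ∷ sorted) ((_ ∷ x≢z ∷ _) ∷ _ ∷ unique) = begin
      c x + (cost x z + m)  ≡⟨ +-assoc (c x) (cost x z) m ⟨
      c x + cost x z + m    ≤⟨ +-monoˡ-≤ m (cost-≤ x≢z x≤z) ⟩
      c z + m               ≤⟨ chain-≤ ch sorted unique ⟩
      c (lastOf z ys)       ∎
      where open ≤-Reasoning

-- Lower bounds from chains

module Budget {V : Set} (cost : V → V → ℕ) (ℓ : V → ℕ) (A : ℕ) where

  Σℓ : List V → ℕ
  Σℓ xs = sum (map ℓ xs)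

  Σℓ-split : ∀ x ys zs → Σℓ (x ∷ ys ++ zs) + ℓ (lastOf x ys) ≡ Σℓ (x ∷ ys) + Σℓ (lastOf x ys ∷ zs)
  Σℓ-split x []       zs = regroup (ℓ x) (Σℓ zs)
    where
      regroup : ∀ a b → a + b + a ≡ a + 0 + (a + b)
      regroup = solve-∀
  Σℓ-split x (y ∷ ys) zs = begin
    ℓ x + Σℓ (y ∷ ys ++ zs) + ℓ (lastOf y ys)            ≡⟨ +-assoc (ℓ x) _ _ ⟩
    ℓ x + (Σℓ (y ∷ ys ++ zs) + ℓ (lastOf y ys))          ≡⟨ cong (ℓ x +_) (Σℓ-split y ys zs) ⟩
    ℓ x + (Σℓ (y ∷ ys) + Σℓ (lastOf y ys ∷ zs))          ≡⟨ +-assoc (ℓ x) _ _ ⟨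
    ℓ x + Σℓ (y ∷ ys) + Σℓ (lastOf y ys ∷ zs)            ∎
    where open ≡-Reasoning

  -- If every step satisfies A ≤ cost u v + ℓ u + ℓ v, a chain through x ∷ ys costs at least
  -- |ys|·A − 2Σℓ + ℓ x + ℓ (last); Gain is the excess over this, Surplus the excess over |ys|·A − 2Σℓ.
  Gain : V → List V → ℕ → Set
  Gain x ys G = ∃ λ m → Chain cost x ys m × (length ys * A + ℓ x + ℓ (lastOf x ys) + G ≤ m + 2 * Σℓ (x ∷ ys))

  Surplus : V → List V → ℕ → Set
  Surplus x ys g = ∃ λ m → Chain cost x ys m × (length ys * A + g ≤ m + 2 * Σℓ (x ∷ ys))

  gain-[] : ∀ x → Gain x [] 0
  gain-[] x = 0 , [] , ≤-reflexive (regroup (ℓ x))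
    where
      regroup : ∀ a → 0 + a + a + 0 ≡ 0 + 2 * (a + 0)
      regroup = solve-∀

  gain-step : ∀ {x y G} → A + G ≤ cost x y + ℓ x + ℓ y → Gain x (y ∷ []) G
  gain-step {x} {y} {G} h = cost x y + 0 , step [] , ≤-rebalance h (regroup A (ℓ x) (ℓ y) G (cost x y))
    where
      regroup : ∀ A a b G d → 1 * A + a + b + G + (d + a + b) ≡ d + 0 + 2 * (a + (b + 0)) + (A + G)
      regroup = solve-∀

  gain-skip : ∀ {x y z G} → A + A + G ≤ cost x z + ℓ x + ℓ z + 2 * ℓ y → Gain x (y ∷ z ∷ []) G
  gain-skip {x} {y} {z} {G} h = cost x z + 0 , skip [] , ≤-rebalance h (regroup A (ℓ x) (ℓ y) (ℓ z) G (cost x z))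
    where
      regroup : ∀ A a b e G d → 2 * A + a + e + G + (d + a + e + 2 * b) ≡ d + 0 + 2 * (a + (b + (e + 0))) + (A + A + G)
      regroup = solve-∀

  gain-++ : ∀ {x ys zs G₁ G₂} → Gain x ys G₁ → Gain (lastOf x ys) zs G₂ → Gain x (ys ++ zs) (G₁ + G₂)
  gain-++ {x} {ys} {zs} {G₁} {G₂} (m₁ , ch₁ , h₁) (m₂ , ch₂ , h₂) =
    m₁ + m₂ , chain-++ cost ch₁ ch₂ , ≤-rebalance (+-mono-≤ h₁ h₂) balance
    where
      a : V
      a = lastOf x ys
      balance : length (ys ++ zs) * A + ℓ x + ℓ (lastOf x (ys ++ zs)) + (G₁ + G₂)
                  + (m₁ + 2 * Σℓ (x ∷ ys) + (m₂ + 2 * Σℓ (a ∷ zs)))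
              ≡ m₁ + m₂ + 2 * Σℓ (x ∷ ys ++ zs)
                  + (length ys * A + ℓ x + ℓ a + G₁ + (length zs * A + ℓ a + ℓ (lastOf a zs) + G₂))
      balance rewrite length-++ ys {zs} | lastOf-++ x ys zs =
        cancel-by (cong (2 *_) (sym (Σℓ-split x ys zs)))
                  (regroup (length ys) (length zs) A (ℓ x) (ℓ a) (ℓ (lastOf a zs)) G₁ G₂ m₁ m₂
                           (Σℓ (x ∷ ys ++ zs)) (Σℓ (x ∷ ys)) (Σℓ (a ∷ zs)))
        where
          regroup : ∀ p q A u a e G₁ G₂ m₁ m₂ S S₁ S₂ →
            (p + q) * A + u + e + (G₁ + G₂) + (m₁ + 2 * S₁ + (m₂ + 2 * S₂)) + 2 * (S + a)
              ≡ m₁ + m₂ + 2 * S + (p * A + u + a + G₁ + (q * A + a + e + G₂)) + 2 * (S₁ + S₂)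
          regroup = solve-∀

  gain⇒surplus : ∀ {x ys G g} → Gain x ys G → g ≤ ℓ x + ℓ (lastOf x ys) + G → Surplus x ys g
  gain⇒surplus {x} {ys} {G} (m , ch , h) g≤ =
    m , ch , ≤-trans (+-monoʳ-≤ (length ys * A) g≤) (≤-trans (≤-reflexive (+-assoc-4 (length ys * A) (ℓ x) (ℓ (lastOf x ys)) G)) h)
    where
      +-assoc-4 : ∀ a b c d → a + (b + c + d) ≡ a + b + c + d
      +-assoc-4 = solve-∀

  surplus-from-ends : ∀ {x ys G g} → Gain x ys G → g ≤ ℓ x + ℓ (lastOf x ys) → Surplus x ys g
  surplus-from-ends {x} {ys} {G} gain g≤ = gain⇒surplus gain (≤-trans g≤ (m≤m+n _ G))

  surplus-from-gain : ∀ {x ys G g} → Gain x ys G → g ≤ G → Surplus x ys g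
  surplus-from-gain {x} {ys} gain g≤ = gain⇒surplus gain (≤-trans g≤ (m≤n+m _ (ℓ x + ℓ (lastOf x ys))))

  surplus-at-first : ∀ {x ys G v g} → Gain x ys G → x ≡ v → g ≤ ℓ v → Surplus x ys g
  surplus-at-first gain refl g≤ = surplus-from-ends gain (≤-trans g≤ (m≤m+n _ _))

  surplus-at-final : ∀ {x ys G v g} → Gain x ys G → lastOf x ys ≡ v → g ≤ ℓ v → Surplus x ys g
  surplus-at-final {x} gain refl g≤ = surplus-from-ends gain (≤-trans g≤ (m≤n+m _ (ℓ x)))

  gain-skipping : ∀ {x p y b q G₁ G G₂} → Gain x p G₁ →
                  A + A + G ≤ cost (lastOf x p) b + ℓ (lastOf x p) + ℓ b + 2 * ℓ y →
                  Gain b q G₂ → Gain x (p ++ y ∷ b ∷ q) (G₁ + (G + G₂))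
  gain-skipping {p = p} {y} {b} gain₁ window gain₂ = gain-++ {ys = p} gain₁ (gain-++ {ys = y ∷ b ∷ []} (gain-skip window) gain₂)

  module Baseline (bonus : V → V → ℕ) (bonus-≤ : ∀ {u v} → u ≢ v → A + bonus u v ≤ cost u v + ℓ u + ℓ v) where

    gain-baseline : ∀ x ys → Unique (x ∷ ys) → Gain x ys (alongPairs bonus x ys)
    gain-baseline x []       _                = gain-[] x
    gain-baseline x (y ∷ ys) ((x≢y ∷ _) ∷ u) = gain-++ {ys = y ∷ []} (gain-step (bonus-≤ x≢y)) (gain-baseline y ys u)

  surplus-one-centre : (z : V) → (∀ u → ℓ u ≡ 0 → u ≡ z) → (∀ {u v} → u ≢ v → A + 0 ≤ cost u v + ℓ u + ℓ v) →
                       ∀ x y ys → Unique (x ∷ y ∷ ys) → Surplus x (y ∷ ys) 1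
  surplus-one-centre z only-z bound x y ys u = surplus-from-ends (gain-baseline x (y ∷ ys) u) (ends-positive (ℓ x) (ℓ (lastOf y ys)) refl refl)
    where
      open Baseline (λ _ _ → 0) bound
      ends-positive : ∀ a e → ℓ x ≡ a → ℓ (lastOf y ys) ≡ e → 1 ≤ a + e
      ends-positive zero    zero    ℓx≡0 ℓe≡0 = ⊥-elim (Unique-head u (lastOf-∈ y ys) (trans (only-z x ℓx≡0) (sym (only-z _ ℓe≡0))))
      ends-positive zero    (suc e) _    _    = s≤s z≤n
      ends-positive (suc a) e       _    _    = s≤s z≤n

  module TwoSides (side : V → Bool)
                  (agree-≤ : ∀ {u v} → u ≢ v → A + agree (side u) (side v) ≤ cost u v + ℓ u + ℓ v) where
    open Baseline (λ u v → agree (side u) (side v)) agree-≤ public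

    bonus : V → List V → ℕ
    bonus = alongPairs (λ u v → agree (side u) (side v))

    same-side-≤ : ∀ {u v} → u ≢ v → side u ≡ true → side v ≡ true → A + 1 ≤ cost u v + ℓ u + ℓ v
    same-side-≤ {u} {v} u≢v su sv = subst (λ t → A + t ≤ cost u v + ℓ u + ℓ v) (cong₂ agree su sv) (agree-≤ u≢v)

    gain-around : ∀ x p y b q {G} → Unique (x ∷ p ++ y ∷ b ∷ q) →
                  (lastOf x p ≢ b → A + A + G ≤ cost (lastOf x p) b + ℓ (lastOf x p) + ℓ b + 2 * ℓ y) →
                  Gain x (p ++ y ∷ b ∷ q) (bonus x p + (G + bonus b q))
    gain-around x p y b q u window =
      gain-skipping (gain-baseline x p (Unique-++ˡ (x ∷ p) u))
                    (window (Unique-++-disjoint (x ∷ p) u (lastOf-∈ x p) (there (here refl))))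
                    (gain-baseline b q (AllPairs.tail (Unique-++ʳ (x ∷ p) u)))

    sides-around : ∀ x p y b q → bonus x (p ++ y ∷ b ∷ q) ≡ 0 → side y ≡ false →
                   side (lastOf x p) ≡ true × side b ≡ true
    sides-around x p y b q none y-false =
      agree-false (subst (λ t → agree (side (lastOf x p)) t ≡ 0) y-false (m+n≡0⇒m≡0 _ around)) ,
      false-agree (subst (λ t → agree t (side b) ≡ 0) y-false (m+n≡0⇒m≡0 _ (m+n≡0⇒n≡0 (agree (side (lastOf x p)) (side y)) around)))
      where
        around : agree (side (lastOf x p)) (side y) + (agree (side y) (side b) + bonus b q) ≡ 0
        around = m+n≡0⇒n≡0 (bonus x p) (trans (sym (alongPairs-++ _ x p (y ∷ b ∷ q))) none)

    skip-heavy : ∀ {a b R} → A ≤ 2 * ℓ R → a ≢ b → side a ≡ true → side b ≡ true →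
                 A + A + 1 ≤ cost a b + ℓ a + ℓ b + 2 * ℓ R
    skip-heavy {R = R} A≤2ℓR a≢b a-true b-true =
      skip-gain 1 1 (same-side-≤ a≢b a-true b-true) (subst (_≤ 1 + 2 * ℓ R) (+-comm 1 A) (s≤s A≤2ℓR))

    surplus-heavy : (R : V) → side R ≡ false → A ≤ 2 * ℓ R → 2 ≤ ℓ R →
                    ∀ x rest → Unique (x ∷ rest) → R ∈ x ∷ rest → Surplus x rest 1
    surplus-heavy R R-false A≤2ℓR 2≤ℓR x rest u R∈ with bonus x rest in none
    ... | suc _ = surplus-from-gain (gain-baseline x rest u) (subst (1 ≤_) (sym none) (s≤s z≤n))
    ... | zero with placement R∈
    ...   | first x≡R   = surplus-at-first (gain-baseline x rest u) x≡R (≤-trans (s≤s z≤n) 2≤ℓR)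
    ...   | final last≡R = surplus-at-final (gain-baseline x rest u) last≡R (≤-trans (s≤s z≤n) 2≤ℓR)
    ...   | middle p b q =
      surplus-from-gain (gain-around x p R b q u window) (≤-middle (bonus x p) (bonus b q) ≤-refl)
      where
        window : lastOf x p ≢ b → A + A + 1 ≤ cost (lastOf x p) b + ℓ (lastOf x p) + ℓ b + 2 * ℓ R
        window a≢b = let (a-true , b-true) = sides-around x p R b q none R-false in skip-heavy A≤2ℓR a≢b a-true b-true

    countTrue countFalse : List V → ℕ
    countTrue  vs = sum (map (λ v → indicator (side v)) vs)
    countFalse vs = sum (map (λ v → indicator (not (side v))) vs)

    count-total : ∀ vs → countTrue vs + countFalse vs ≡ length vs
    count-total []       = refl
    count-total (v ∷ vs) = trans (interchange (indicator (side v)) _ (indicator (not (side v))) _)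
                                 (cong₂ _+_ (indicator-not (side v)) (count-total vs))

    pairsTT pairsFF : V → List V → ℕ
    pairsTT = alongPairs (λ u v → indicator (side u ∧ side v))
    pairsFF = alongPairs (λ u v → indicator (not (side u ∨ side v)))

    bonus-split : ∀ x ys → bonus x ys ≡ pairsTT x ys + pairsFF x ys
    bonus-split = alongPairs-+ (λ u v → indicator (side u ∧ side v)) (λ u v → indicator (not (side u ∨ side v)))

    pairs-balance : ∀ x ys → pairsTT x ys + countFalse (x ∷ ys) + indicator (side x) + indicator (side (lastOf x ys))
                             ≡ pairsFF x ys + countTrue (x ∷ ys) + 1
    pairs-balance x [] with side x
    ... | true  = refl
    ... | false = refl
    pairs-balance x (y ∷ ys) =
      pairs-balance-step (side x) (side y) (pairsTT y ys) (countFalse (y ∷ ys)) (indicator (side (lastOf y ys)))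
                         (pairsFF y ys) (countTrue (y ∷ ys)) (pairs-balance y ys)

    -- Either the ends and same-side pairs give surplus 2, or the order alternates sides; then a window
    -- around R gives it, or, when R is next to the centre w at an end, windows around R and Q do.
    module Balanced (_≟_ : DecidableEquality V)
                    (w w' : V) (w-true : side w ≡ true) (w'-false : side w' ≡ false)
                    (level-zero : ∀ u → ℓ u ≡ 0 → u ≡ w ⊎ u ≡ w')
                    (R Q : V) (R-false : side R ≡ false) (Q-false : side Q ≡ false) (Q≢R : Q ≢ R)
                    (A≤2ℓR : A ≤ 2 * ℓ R) (2≤ℓR : 2 ≤ ℓ R) (A≤2+2ℓQ : A ≤ 2 + 2 * ℓ Q) (1≤ℓQ : 1 ≤ ℓ Q)
                    (off-w-≤ : ∀ {a b} → a ≢ b → side a ≡ true → side b ≡ true → a ≢ w → b ≢ w →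
                               A + 3 ≤ cost a b + ℓ a + ℓ b) where

      true≢false : ∀ {u} → side u ≡ true → side u ≢ false
      true≢false u-true u-false with trans (sym u-true) u-false
      ... | ()

      level-zero-by-side : ∀ {u v} → ℓ u ≡ 0 → ℓ v ≡ 0 → side u ≡ side v → u ≡ v
      level-zero-by-side {u} {v} ℓu≡0 ℓv≡0 same with level-zero u ℓu≡0 | level-zero v ℓv≡0
      ... | inj₁ u≡w  | inj₁ v≡w  = trans u≡w (sym v≡w)
      ... | inj₂ u≡w' | inj₂ v≡w' = trans u≡w' (sym v≡w')
      ... | inj₁ refl | inj₂ refl = ⊥-elim (true≢false w-true (trans same w'-false))
      ... | inj₂ refl | inj₁ refl = ⊥-elim (true≢false w-true (trans (sym same) w'-false))

      interior-≢w : ∀ {x e v} → ℓ x ≡ 0 → ℓ e ≡ 0 → x ≢ e → v ≢ x → v ≢ e → v ≢ w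
      interior-≢w {x} {e} ℓx≡0 ℓe≡0 x≢e v≢x v≢e v≡w with level-zero x ℓx≡0 | level-zero e ℓe≡0
      ... | inj₁ x≡w  | _         = v≢x (trans v≡w (sym x≡w))
      ... | _         | inj₁ e≡w  = v≢e (trans v≡w (sym e≡w))
      ... | inj₂ x≡w' | inj₂ e≡w' = x≢e (trans x≡w' (sym e≡w'))

      skip-Q : ∀ {a b} → a ≢ b → side a ≡ true → side b ≡ true → a ≢ w → b ≢ w →
               A + A + 1 ≤ cost a b + ℓ a + ℓ b + 2 * ℓ Q
      skip-Q {a} {b} a≢b a-true b-true a≢w b≢w =
        skip-gain 3 1 (off-w-≤ a≢b a-true b-true a≢w b≢w) (subst (_≤ 3 + 2 * ℓ Q) (+-comm 1 A) (s≤s A≤2+2ℓQ))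

      skip-R-off-w : ∀ {a b} → a ≢ b → side a ≡ true → side b ≡ true → a ≢ w → b ≢ w →
                     A + A + 3 ≤ cost a b + ℓ a + ℓ b + 2 * ℓ R
      skip-R-off-w {a} {b} a≢b a-true b-true a≢w b≢w =
        skip-gain 3 3 (off-w-≤ a≢b a-true b-true a≢w b≢w) (subst (_≤ 3 + 2 * ℓ R) (+-comm 3 A) (+-monoʳ-≤ 3 A≤2ℓR))

      surplus-after-w : ∀ b q → Unique (w ∷ R ∷ b ∷ q) → Q ∈ w ∷ R ∷ b ∷ q → bonus w (R ∷ b ∷ q) ≡ 0 →
                        side b ≡ true → ℓ (lastOf b q) ≡ 0 → Surplus w (R ∷ b ∷ q) 2
      surplus-after-w b q u (here Q≡w)                 _    _      _    = ⊥-elim (true≢false (trans (cong side Q≡w) w-true) Q-false)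
      surplus-after-w b q u (there (here Q≡R))         _    _      _    = ⊥-elim (Q≢R Q≡R)
      surplus-after-w b q u (there (there Q∈)) none b-true ℓe≡0 with placement Q∈
      ... | first b≡Q  = ⊥-elim (true≢false (trans (cong side (sym b≡Q)) b-true) Q-false)
      ... | final e≡Q  = ⊥-elim (<⇒≢ 1≤ℓQ (sym (trans (cong ℓ (sym e≡Q)) ℓe≡0)))
      ... | middle r₁ b' r₂ =
        surplus-from-gain (gain-skipping {p = []} (gain-[] w) (skip-heavy A≤2ℓR (Unique-head u (there (here refl))) w-true b-true)
                                         (gain-around b r₁ Q b' r₂ (AllPairs.tail (AllPairs.tail u)) window))
                          (+-monoʳ-≤ 1 (≤-middle (bonus b r₁) (bonus b' r₂) ≤-refl))
        where
          sides : side (lastOf b r₁) ≡ true × side b' ≡ true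
          sides = sides-around b r₁ Q b' r₂ (m+n≡0⇒n≡0 (agree (side R) (side b)) (m+n≡0⇒n≡0 (agree (side w) (side R)) none)) Q-false
          window : lastOf b r₁ ≢ b' → A + A + 1 ≤ cost (lastOf b r₁) b' + ℓ (lastOf b r₁) + ℓ b' + 2 * ℓ Q
          window a'≢b' = skip-Q a'≢b' (proj₁ sides) (proj₂ sides)
            (≢-sym (Unique-head u (there (∈-++⁺ˡ (lastOf-∈ b r₁)))))
            (≢-sym (Unique-head u (there (there (∈-++⁺ʳ r₁ (there (here refl)))))))

      Q∈-before-R : ∀ {x} p → Q ∈ x ∷ p ++ R ∷ w ∷ [] → Q ∈ x ∷ p
      Q∈-before-R p (here Q≡x) = here Q≡x
      Q∈-before-R p (there Q∈) with ∈-++⁻ p Q∈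
      ... | inj₁ Q∈p                 = there Q∈p
      ... | inj₂ (here Q≡R)          = ⊥-elim (Q≢R Q≡R)
      ... | inj₂ (there (here Q≡w)) = ⊥-elim (true≢false (trans (cong side Q≡w) w-true) Q-false)

      surplus-before-w : ∀ x p → Unique (x ∷ p ++ R ∷ w ∷ []) → Q ∈ x ∷ p ++ R ∷ w ∷ [] → bonus x (p ++ R ∷ w ∷ []) ≡ 0 →
                         ℓ x ≡ 0 → side (lastOf x p) ≡ true → Surplus x (p ++ R ∷ w ∷ []) 2
      surplus-before-w x p u Q∈ none ℓx≡0 a-true with placement (Q∈-before-R p Q∈)
      ... | first x≡Q  = ⊥-elim (<⇒≢ 1≤ℓQ (sym (trans (cong ℓ (sym x≡Q)) ℓx≡0)))
      ... | final a≡Q  = ⊥-elim (true≢false (trans (cong side (sym a≡Q)) a-true) Q-false)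
      ... | middle r₁ b' r₂ =
        surplus-from-gain (gain-skipping (gain-around x r₁ Q b' r₂ (Unique-++ˡ (x ∷ p) u) window)
                                         (skip-heavy A≤2ℓR (off-w (lastOf-∈ x p)) a-true w-true) (gain-[] w))
                          (+-mono-≤ (≤-middle (bonus x r₁) (bonus b' r₂) ≤-refl) (≤-refl {1}))
        where
          off-w : ∀ {v} → v ∈ x ∷ p → v ≢ w
          off-w v∈ = Unique-++-disjoint (x ∷ p) u v∈ (there (here refl))
          sides : side (lastOf x r₁) ≡ true × side b' ≡ true
          sides = sides-around x r₁ Q b' r₂ (m+n≡0⇒m≡0 _ (trans (sym (alongPairs-++ _ x p (R ∷ w ∷ []))) none)) Q-false
          window : lastOf x r₁ ≢ b' → A + A + 1 ≤ cost (lastOf x r₁) b' + ℓ (lastOf x r₁) + ℓ b' + 2 * ℓ Q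
          window a'≢b' = skip-Q a'≢b' (proj₁ sides) (proj₂ sides) (off-w (∈-++⁺ˡ (lastOf-∈ x r₁))) (off-w (there (∈-++⁺ʳ r₁ (there (here refl)))))

      surplus-zero-ends : ∀ x p b q → Unique (x ∷ p ++ R ∷ b ∷ q) → Q ∈ x ∷ p ++ R ∷ b ∷ q →
                          bonus x (p ++ R ∷ b ∷ q) ≡ 0 → ℓ x ≡ 0 → ℓ (lastOf x (p ++ R ∷ b ∷ q)) ≡ 0 →
                          side (lastOf x p) ≡ true → side b ≡ true → Surplus x (p ++ R ∷ b ∷ q) 2
      surplus-zero-ends x p b q u Q∈ none ℓx≡0 ℓe≡0 a-true b-true with lastOf x p ≟ w | b ≟ w
      ... | no a≢w | no b≢w =
        surplus-from-gain (gain-around x p R b q u (λ a≢b → skip-R-off-w a≢b a-true b-true a≢w b≢w))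
                          (≤-middle (bonus x p) (bonus b q) (s≤s (s≤s z≤n)))
      surplus-zero-ends x []      b q u Q∈ none ℓx≡0 ℓe≡0 a-true b-true | yes refl | _ =
        surplus-after-w b q u Q∈ none b-true ℓe≡0
      surplus-zero-ends x (y ∷ p) b q u Q∈ none ℓx≡0 ℓe≡0 a-true b-true | yes a≡w | _ =
        ⊥-elim (interior-≢w ℓx≡0 ℓe≡0 (Unique-head u (∈-++⁺ʳ (y ∷ p) e∈))
                  (≢-sym (Unique-head u (∈-++⁺ˡ (lastOf-∈ y p))))
                  (Unique-++-disjoint (x ∷ y ∷ p) u (lastOf-∈ x (y ∷ p)) e∈) a≡w)
        where
          e∈ : lastOf x (y ∷ p ++ R ∷ b ∷ q) ∈ R ∷ b ∷ q
          e∈ = lastOf-∈-suffix x (y ∷ p) R (b ∷ q)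
      surplus-zero-ends x p b []      u Q∈ none ℓx≡0 ℓe≡0 a-true b-true | no _ | yes refl =
        surplus-before-w x p u Q∈ none ℓx≡0 a-true
      surplus-zero-ends x p b (c ∷ q) u Q∈ none ℓx≡0 ℓe≡0 a-true b-true | no _ | yes b≡w =
        ⊥-elim (interior-≢w ℓx≡0 ℓe≡0 (Unique-head u (∈-++⁺ʳ p (lastOf-∈-suffix x p R (b ∷ c ∷ q))))
                  (≢-sym (Unique-head u (∈-++⁺ʳ p (there (here refl)))))
                  (λ b≡e → Unique-head (AllPairs.tail (Unique-++ʳ (x ∷ p) u)) (lastOf-∈ c q) (trans b≡e (lastOf-++ x p (R ∷ b ∷ c ∷ q))))
                  b≡w)

      surplus-alternating : ∀ x rest → Unique (x ∷ rest) → R ∈ x ∷ rest → Q ∈ x ∷ rest → bonus x rest ≡ 0 →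
                            Surplus x rest 2
      surplus-alternating x rest u R∈ Q∈ none with placement R∈
      ... | first x≡R    = surplus-at-first (gain-baseline x rest u) x≡R 2≤ℓR
      ... | final e≡R    = surplus-at-final (gain-baseline x rest u) e≡R 2≤ℓR
      ... | middle p b q = around-R (sides-around x p R b q none R-false)
        where
          around-R : side (lastOf x p) ≡ true × side b ≡ true → Surplus x (p ++ R ∷ b ∷ q) 2
          around-R (a-true , b-true) with ℓ x + ℓ (lastOf x (p ++ R ∷ b ∷ q)) in ends
          ... | suc _ = gain⇒surplus (gain-around x p R b q u (λ a≢b → skip-heavy A≤2ℓR a≢b a-true b-true))
                                     (+-mono-≤ (subst (1 ≤_) (sym ends) (s≤s z≤n)) (≤-middle (bonus x p) (bonus b q) ≤-refl))
          ... | zero  = surplus-zero-ends x p b q u Q∈ none (m+n≡0⇒m≡0 _ ends) (m+n≡0⇒n≡0 (ℓ x) ends) a-true b-true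

      ends-positive : ∀ x y ys → Unique (x ∷ y ∷ ys) → side x ≡ side (lastOf y ys) → 1 ≤ ℓ x + ℓ (lastOf y ys)
      ends-positive x y ys u same with ℓ x in ℓx | ℓ (lastOf y ys) in ℓe
      ... | suc _ | _     = s≤s z≤n
      ... | zero  | suc _ = s≤s z≤n
      ... | zero  | zero  = ⊥-elim (Unique-head u (lastOf-∈ y ys) (level-zero-by-side ℓx ℓe same))

      surplus-balanced : ∀ x rest → Unique (x ∷ rest) → R ∈ x ∷ rest → Q ∈ x ∷ rest →
                         countTrue (x ∷ rest) ≡ countFalse (x ∷ rest) → Surplus x rest 2
      surplus-balanced x []       _ (here R≡x) (here Q≡x) _ = ⊥-elim (Q≢R (trans Q≡x (sym R≡x)))
      surplus-balanced x (y ∷ ys) u R∈ Q∈ counts = by-ends (side x) (side (lastOf y ys)) refl refl balance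
        where
          open ≡-Reasoning
          TT FF : ℕ
          TT = pairsTT x (y ∷ ys)
          FF = pairsFF x (y ∷ ys)

          balance : TT + (indicator (side x) + indicator (side (lastOf y ys))) ≡ FF + 1
          balance = +-cancelʳ-≡ (countFalse (x ∷ y ∷ ys)) _ _ (begin
            TT + (indicator (side x) + indicator (side (lastOf y ys))) + countFalse (x ∷ y ∷ ys)
              ≡⟨ regroup TT _ _ _ ⟩
            TT + countFalse (x ∷ y ∷ ys) + indicator (side x) + indicator (side (lastOf y ys))
              ≡⟨ pairs-balance x (y ∷ ys) ⟩
            FF + countTrue (x ∷ y ∷ ys) + 1
              ≡⟨ cong (λ t → FF + t + 1) counts ⟩
            FF + countFalse (x ∷ y ∷ ys) + 1
              ≡⟨ +-comm-middle FF _ 1 ⟩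
            FF + 1 + countFalse (x ∷ y ∷ ys) ∎)
            where
              regroup : ∀ T i j C → T + (i + j) + C ≡ T + C + i + j
              regroup = solve-∀
              +-comm-middle : ∀ a b c → a + b + c ≡ a + c + b
              +-comm-middle = solve-∀

          bonus≡ : bonus x (y ∷ ys) ≡ TT + FF
          bonus≡ = bonus-split x (y ∷ ys)

          surplus-from-pairs : 1 ≤ ℓ x + ℓ (lastOf y ys) → 1 ≤ TT + FF → Surplus x (y ∷ ys) 2
          surplus-from-pairs ends pairs =
            gain⇒surplus (gain-baseline x (y ∷ ys) u) (+-mono-≤ ends (subst (1 ≤_) (sym bonus≡) pairs))

          alternate-or-pairs : TT ≡ FF → Surplus x (y ∷ ys) 2
          alternate-or-pairs TT≡FF with TT in TT≡
          ... | suc _ = surplus-from-gain (gain-baseline x (y ∷ ys) u)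
                          (subst (2 ≤_) (sym bonus≡) (+-mono-≤ (subst (1 ≤_) (sym TT≡) (s≤s z≤n)) (subst (1 ≤_) TT≡FF (s≤s z≤n))))
          ... | zero  = surplus-alternating x (y ∷ ys) u R∈ Q∈ (trans bonus≡ (cong₂ _+_ TT≡ (sym TT≡FF)))

          by-ends : ∀ bx be → side x ≡ bx → side (lastOf y ys) ≡ be → TT + (indicator bx + indicator be) ≡ FF + 1 →
                    Surplus x (y ∷ ys) 2
          by-ends true true x-true e-true bal =
            surplus-from-pairs (ends-positive x y ys u (trans x-true (sym e-true)))
              (≤-trans (+-cancelʳ-≤ 1 1 FF (≤-trans (m≤n+m 2 TT) (≤-reflexive bal))) (m≤n+m FF TT))
          by-ends false false x-false e-false bal =
            surplus-from-pairs (ends-positive x y ys u (trans x-false (sym e-false)))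
              (≤-trans (≤-trans (m≤n+m 1 FF) (≤-reflexive (trans (sym bal) (+-identityʳ TT)))) (m≤m+n TT FF))
          by-ends true  false _ _ bal = alternate-or-pairs (+-cancelʳ-≡ 1 TT FF bal)
          by-ends false true  _ _ bal = alternate-or-pairs (+-cancelʳ-≡ 1 TT FF bal)

-- The spire graph

label-injective : ∀ {n} {u v : Fin n} → label u ≡ label v → u ≡ v
label-injective eq = toℕ-injective (suc-injective eq)

vertexAt : ∀ {n} l → 1 ≤ l → l ≤ n → Σ (Fin n) λ v → label v ≡ l
vertexAt {n} l 1≤l l≤n = fromℕ< l-1<n , trans (cong suc (toℕ-fromℕ< l-1<n)) (m+[n∸m]≡n 1≤l)
  where
    l-1<n : l ∸ 1 < n
    l-1<n = ≤-trans (≤-reflexive (m+[n∸m]≡n 1≤l)) l≤n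

∣n-1+n∣≡1 : ∀ a → ∣ a - suc a ∣ ≡ 1
∣n-1+n∣≡1 a = trans (cong (λ b → ∣ a - b ∣) (+-comm 1 a)) (∣m-m+n∣≡n a 1)

∣-∣-step : ∀ u a → ∣ u - suc a ∣ ≤ suc ∣ u - a ∣ × ∣ u - a ∣ ≤ suc ∣ u - suc a ∣
∣-∣-step u a =
  ≤-trans (∣-∣-triangle u a (suc a)) (≤-reflexive (trans (cong (∣ u - a ∣ +_) (∣n-1+n∣≡1 a)) (+-comm _ 1))) ,
  ≤-trans (∣-∣-triangle u (suc a) a)
          (≤-reflexive (trans (cong (∣ u - suc a ∣ +_) (trans (∣-∣-comm (suc a) a) (∣n-1+n∣≡1 a))) (+-comm _ 1)))

module SpireDistance (m s : ℕ) (1≤s : 1 ≤ s) (s≤m : s ≤ m) where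

  n : ℕ
  n = suc m

  Adj : Fin n → Fin n → Set
  Adj = SpireAdj n s

  -- Labels 1, …, m form the path and n = m + 1 is the tip, adjacent to s.
  opaque
    spireDist : ℕ → ℕ → ℕ
    spireDist i j with i ≟ n | j ≟ n
    ... | yes _ | yes _ = 0
    ... | yes _ | no  _ = suc ∣ s - j ∣
    ... | no  _ | yes _ = suc ∣ s - i ∣
    ... | no  _ | no  _ = ∣ i - j ∣

    dist-tip-tip : spireDist n n ≡ 0
    dist-tip-tip with n ≟ n
    ... | yes _  = refl
    ... | no n≢n = ⊥-elim (n≢n refl)

    dist-tip-path : ∀ {j} → j ≢ n → spireDist n j ≡ suc ∣ s - j ∣
    dist-tip-path {j} j≢n with n ≟ n | j ≟ n
    ... | yes _  | no _    = refl
    ... | no n≢n | _       = ⊥-elim (n≢n refl)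
    ... | _      | yes j≡n = ⊥-elim (j≢n j≡n)

    dist-path-tip : ∀ {i} → i ≢ n → spireDist i n ≡ suc ∣ s - i ∣
    dist-path-tip {i} i≢n with i ≟ n | n ≟ n
    ... | no _    | yes _  = refl
    ... | _       | no n≢n = ⊥-elim (n≢n refl)
    ... | yes i≡n | _      = ⊥-elim (i≢n i≡n)

    dist-path-path : ∀ {i j} → i ≢ n → j ≢ n → spireDist i j ≡ ∣ i - j ∣
    dist-path-path {i} {j} i≢n j≢n with i ≟ n | j ≟ n
    ... | no _    | no _    = refl
    ... | yes i≡n | _       = ⊥-elim (i≢n i≡n)
    ... | _       | yes j≡n = ⊥-elim (j≢n j≡n)

    tipElse : {X : Set} → X → (ℕ → X) → ℕ → X
    tipElse t f i with i ≟ n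
    ... | yes _ = t
    ... | no  _ = f i

    tipElse-tip : ∀ {X : Set} {t : X} {f} → tipElse t f n ≡ t
    tipElse-tip with n ≟ n
    ... | yes _  = refl
    ... | no n≢n = ⊥-elim (n≢n refl)

    tipElse-path : ∀ {X : Set} {t : X} {f i} → i ≢ n → tipElse t f i ≡ f i
    tipElse-path {i = i} i≢n with i ≟ n
    ... | yes i≡n = ⊥-elim (i≢n i≡n)
    ... | no  _   = refl

  -- Seen from the path, the tip sits one step above position s.
  position : ℕ → ℕ
  position = tipElse s (λ i → i)

  offset : ℕ → ℕ
  offset = tipElse 1 (λ _ → 0)

  position-tip : position n ≡ s
  position-tip = tipElse-tip

  position-path : ∀ {i} → i ≢ n → position i ≡ i
  position-path = tipElse-path

  offset-tip : offset n ≡ 1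
  offset-tip = tipElse-tip

  offset-path : ∀ {i} → i ≢ n → offset i ≡ 0
  offset-path = tipElse-path

  offset-zero⇒path : ∀ {i} → offset i ≡ 0 → i ≢ n
  offset-zero⇒path offset≡0 refl = 1+n≢0 (trans (sym offset-tip) offset≡0)

  position-≢ : ∀ {i c} → s ≢ c → i ≢ c → position i ≢ c
  position-≢ {i} {c} s≢c i≢c = by-kind (i ≟ n)
    where
      by-kind : Dec (i ≡ n) → position i ≢ c
      by-kind (yes refl) = subst (_≢ c) (sym position-tip) s≢c
      by-kind (no i≢n)   = subst (_≢ c) (sym (position-path i≢n)) i≢c

  dist-≤-position : ∀ i j → spireDist i j ≤ ∣ position i - position j ∣ + offset i + offset j
  dist-≤-position i j = by-kind (i ≟ n) (j ≟ n)
    where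
      by-kind : Dec (i ≡ n) → Dec (j ≡ n) → spireDist i j ≤ ∣ position i - position j ∣ + offset i + offset j
      by-kind (yes refl) (yes refl) rewrite dist-tip-tip = z≤n
      by-kind (yes refl) (no j≢n)
        rewrite dist-tip-path j≢n | position-tip | offset-tip | position-path j≢n | offset-path j≢n =
        ≤-reflexive (trans (+-comm 1 _) (sym (+-identityʳ _)))
      by-kind (no i≢n) (yes refl)
        rewrite dist-path-tip i≢n | position-tip | offset-tip | position-path i≢n | offset-path i≢n =
        ≤-reflexive (trans (cong suc (∣-∣-comm s i)) (trans (+-comm 1 _) (cong (_+ 1) (sym (+-identityʳ _)))))
      by-kind (no i≢n) (no j≢n)
        rewrite dist-path-path i≢n j≢n | position-path i≢n | offset-path i≢n | position-path j≢n | offset-path j≢n =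
        ≤-reflexive (sym (trans (+-identityʳ _) (+-identityʳ _)))

  dist-self : ∀ i → spireDist i i ≡ 0
  dist-self i = by-kind (i ≟ n)
    where
      by-kind : Dec (i ≡ n) → spireDist i i ≡ 0
      by-kind (yes i≡n) = subst (λ t → spireDist t t ≡ 0) (sym i≡n) dist-tip-tip
      by-kind (no  i≢n) = trans (dist-path-path i≢n i≢n) (∣n-n∣≡0 i)

  path-≢n : ∀ {i} → i ≤ m → i ≢ n
  path-≢n i≤m = <⇒≢ (s≤s i≤m)

  s≢n : s ≢ n
  s≢n = path-≢n s≤m

  dist-edge : ∀ u {a b} → SpireEdge n s a b → spireDist u b ≤ suc (spireDist u a) × spireDist u a ≤ suc (spireDist u b)
  dist-edge u {a} (inj₁ (refl , 1+a≤m)) = along-path (u ≟ n)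
    where
      a≢n : a ≢ n
      a≢n = path-≢n (≤-trans (n≤1+n a) 1+a≤m)
      1+a≢n : suc a ≢ n
      1+a≢n = path-≢n 1+a≤m
      along-path : Dec (u ≡ n) → spireDist u (suc a) ≤ suc (spireDist u a) × spireDist u a ≤ suc (spireDist u (suc a))
      along-path (yes refl) rewrite dist-tip-path a≢n | dist-tip-path 1+a≢n = s≤s (proj₁ (∣-∣-step s a)) , s≤s (proj₂ (∣-∣-step s a))
      along-path (no u≢n)   rewrite dist-path-path u≢n a≢n | dist-path-path u≢n 1+a≢n = ∣-∣-step u a
  dist-edge u (inj₂ (refl , refl)) = along-tip-edge (u ≟ n)
    where
      along-tip-edge : Dec (u ≡ n) → spireDist u n ≤ suc (spireDist u s) × spireDist u s ≤ suc (spireDist u n)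
      along-tip-edge (yes refl) rewrite dist-tip-tip | dist-tip-path s≢n | ∣n-n∣≡0 s = z≤n , s≤s z≤n
      along-tip-edge (no u≢n)   rewrite dist-path-tip u≢n | dist-path-path u≢n s≢n =
        s≤s (≤-reflexive (∣-∣-comm s u)) , ≤-trans (≤-reflexive (∣-∣-comm u s)) (≤-trans (n≤1+n _) (n≤1+n _))

  dist-adj : ∀ u {x y} → Adj x y → spireDist u (label y) ≤ suc (spireDist u (label x))
  dist-adj u (inj₁ edge) = proj₁ (dist-edge u edge)
  dist-adj u (inj₂ edge) = proj₂ (dist-edge u edge)

  walk-length-≥ : ∀ {x y k} → Walk Adj x y k → spireDist (label x) (label y) ≤ k
  walk-length-≥ {x} walk = ≤-trans (from (label x) walk) (≤-reflexive (cong (_+ _) (dist-self (label x))))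
    where
      from : ∀ u {x y k} → Walk Adj x y k → spireDist u (label y) ≤ spireDist u (label x) + k
      from u here = ≤-reflexive (sym (+-identityʳ _))
      from u {x} (step {v = v} {k = k} adj walk) = begin
        spireDist u (label _)              ≤⟨ from u walk ⟩
        spireDist u (label v) + k          ≤⟨ +-monoˡ-≤ k (dist-adj u adj) ⟩
        suc (spireDist u (label x)) + k    ≡⟨ +-suc _ k ⟨
        spireDist u (label x) + suc k      ∎
        where open ≤-Reasoning

  adj-sym : ∀ {x y} → Adj x y → Adj y x
  adj-sym (inj₁ edge) = inj₂ edge
  adj-sym (inj₂ edge) = inj₁ edge

  walk-snoc : ∀ {x y z k} → Walk Adj x y k → Adj y z → Walk Adj x z (suc k)
  walk-snoc here          adj = step adj here
  walk-snoc (step a walk) adj = step a (walk-snoc walk adj)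

  walk-reverse : ∀ {x y k} → Walk Adj x y k → Walk Adj y x k
  walk-reverse here          = here
  walk-reverse (step a walk) = walk-snoc (walk-reverse walk) (adj-sym a)

  walk-up : ∀ k (x y : Fin n) → toℕ y ≡ toℕ x + k → label y ≤ m → Walk Adj x y k
  walk-up zero    x y y≡x _ = subst (λ z → Walk Adj x z 0) (toℕ-injective (trans (sym (+-identityʳ _)) (sym y≡x))) here
  walk-up (suc k) x y y≡x+k y≤m = step (inj₁ (inj₁ (cong suc next≡ , ≤-trans (s≤s (≤-trans (≤-reflexive next≡) x<y)) y≤m)))
                                       (walk-up k next y (trans y≡1+x+k (cong (_+ k) (sym next≡))) y≤m)
    where
      y≡1+x+k : toℕ y ≡ suc (toℕ x) + k
      y≡1+x+k = trans y≡x+k (+-suc (toℕ x) k)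
      x<y : suc (toℕ x) ≤ toℕ y
      x<y = ≤-trans (m≤m+n (suc (toℕ x)) k) (≤-reflexive (sym y≡1+x+k))
      1+x<n : suc (toℕ x) < n
      1+x<n = ≤-trans (s≤s x<y) (m≤n⇒m≤1+n y≤m)
      next : Fin n
      next = fromℕ< 1+x<n
      next≡ : toℕ next ≡ suc (toℕ x)
      next≡ = toℕ-fromℕ< 1+x<n

  path-walk : ∀ (x y : Fin n) → label x ≤ m → label y ≤ m → Walk Adj x y ∣ label x - label y ∣
  path-walk x y x≤m y≤m with toℕ x ≤? toℕ y
  ... | yes x≤y = subst (Walk Adj x y) (sym (trans (∣-∣-comm (toℕ x) (toℕ y)) (m≤n⇒∣n-m∣≡n∸m x≤y)))
                        (walk-up (toℕ y ∸ toℕ x) x y (sym (m+[n∸m]≡n x≤y)) y≤m)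
  ... | no  x≰y = subst (Walk Adj x y) (sym (m≤n⇒∣n-m∣≡n∸m y≤x))
                        (walk-reverse (walk-up (toℕ x ∸ toℕ y) y x (sym (m+[n∸m]≡n y≤x)) x≤m))
    where
      y≤x : toℕ y ≤ toℕ x
      y≤x = <⇒≤ (≰⇒> x≰y)

  label-≤ : ∀ (x : Fin n) → label x ≢ n → label x ≤ m
  label-≤ x x≢n = ≤-pred (≤∧≢⇒< (toℕ<n x) x≢n)

  hub : Σ (Fin n) λ v → label v ≡ s
  hub = vertexAt s 1≤s (m≤n⇒m≤1+n s≤m)

  shortest-walk : ∀ x y → Dec (label x ≡ n) → Dec (label y ≡ n) → Walk Adj x y (spireDist (label x) (label y))
  shortest-walk x y (yes x≡n) (yes y≡n) rewrite label-injective {u = x} {y} (trans x≡n (sym y≡n)) =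
    subst (Walk Adj y y) (sym (dist-self (label y))) here
  shortest-walk x y (yes x≡n) (no y≢n) =
    subst (Walk Adj x y) (sym (trans (cong (λ t → spireDist t (label y)) x≡n) (dist-tip-path y≢n)))
          (step (inj₂ (inj₂ (proj₂ hub , x≡n)))
                (subst (λ t → Walk Adj (proj₁ hub) y ∣ t - label y ∣) (proj₂ hub)
                       (path-walk (proj₁ hub) y (≤-trans (≤-reflexive (proj₂ hub)) s≤m) (label-≤ y y≢n))))
  shortest-walk x y (no x≢n) (yes y≡n) =
    subst (Walk Adj x y) (trans (trans (cong (λ t → spireDist t (label x)) y≡n) (dist-tip-path x≢n))
                                (sym (trans (cong (spireDist (label x)) y≡n) (dist-path-tip x≢n))))
          (walk-reverse (shortest-walk y x (yes y≡n) (no x≢n)))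
  shortest-walk x y (no x≢n) (no y≢n) =
    subst (Walk Adj x y) (sym (dist-path-path x≢n y≢n)) (path-walk x y (label-≤ x x≢n) (label-≤ y y≢n))

  spireDist-isDist : ∀ x y → Dist Adj x y (spireDist (label x) (label y))
  spireDist-isDist x y = shortest-walk x y (label x ≟ n) (label y ≟ n) , λ _ → walk-length-≥

  diameter-≥ : ∀ {D} → IsDiameter Adj D → m ∸ 1 ≤ D
  diameter-≥ (bounded , _) = subst (_≤ _) ends-dist (bounded fzero (proj₁ vₘ) _ (spireDist-isDist fzero (proj₁ vₘ)))
    where
      1≤m : 1 ≤ m
      1≤m = ≤-trans 1≤s s≤m
      vₘ : Σ (Fin n) λ v → label v ≡ m
      vₘ = vertexAt m 1≤m (n≤1+n m)
      ends-dist : spireDist 1 (label (proj₁ vₘ)) ≡ m ∸ 1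
      ends-dist = trans (cong (spireDist 1) (proj₂ vₘ))
                        (trans (dist-path-path (path-≢n 1≤m) (path-≢n ≤-refl)) (m≤n⇒∣m-n∣≡n∸m 1≤m))

  radio-≥ : ∀ {D c} → IsDiameter Adj D → IsRadioLabeling Adj D c →
            ∀ {u v} → u ≢ v → m ≤ spireDist (label u) (label v) + ∣ c u - c v ∣
  radio-≥ diameter (_ , separated) u≢v =
    ≤-trans (≤-trans (m≤n+m∸n m 1) (s≤s (diameter-≥ diameter))) (separated _ _ u≢v _ (spireDist-isDist _ _))

-- Level functions

∣-∣-via : ∀ x y a b → ∣ x - y ∣ ≤ ∣ x - a ∣ + ∣ a - b ∣ + ∣ y - b ∣
∣-∣-via x y a b = begin
  ∣ x - y ∣                         ≤⟨ ∣-∣-triangle x a y ⟩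
  ∣ x - a ∣ + ∣ a - y ∣             ≤⟨ +-monoʳ-≤ ∣ x - a ∣ (∣-∣-triangle a b y) ⟩
  ∣ x - a ∣ + (∣ a - b ∣ + ∣ b - y ∣) ≡⟨ +-assoc ∣ x - a ∣ _ _ ⟨
  ∣ x - a ∣ + ∣ a - b ∣ + ∣ b - y ∣ ≡⟨ cong (∣ x - a ∣ + ∣ a - b ∣ +_) (∣-∣-comm b y) ⟩
  ∣ x - a ∣ + ∣ a - b ∣ + ∣ y - b ∣ ∎
  where open ≤-Reasoning

∣-∣≡∸+∸ : ∀ i k → ∣ i - k ∣ ≡ (k ∸ i) + (i ∸ k)
∣-∣≡∸+∸ zero    zero    = refl
∣-∣≡∸+∸ zero    (suc k) = sym (+-identityʳ (suc k))
∣-∣≡∸+∸ (suc i) zero    = refl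
∣-∣≡∸+∸ (suc i) (suc k) = ∣-∣≡∸+∸ i k

<ᵇ-true : ∀ {i k} → i ≤ k → (i <ᵇ suc k) ≡ true
<ᵇ-true z≤n     = refl
<ᵇ-true (s≤s h) = <ᵇ-true h

<ᵇ-false : ∀ {i k} → k < i → (i <ᵇ suc k) ≡ false
<ᵇ-false {k = zero}  (s≤s z≤n)       = refl
<ᵇ-false {k = suc k} (s≤s h@(s≤s _)) = <ᵇ-false h

<ᵇ-true⇒≤ : ∀ i k → (i <ᵇ suc k) ≡ true → i ≤ k
<ᵇ-true⇒≤ i k eq with i ≤? k
... | yes i≤k = i≤k
... | no  i≰k with trans (sym eq) (<ᵇ-false (≰⇒> i≰k))
...   | ()

module OneCentre (m s k : ℕ) (1≤s : 1 ≤ s) (s≤m : s ≤ m) where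
  open SpireDistance m s 1≤s s≤m

  level : ℕ → ℕ
  level i = ∣ position i - k ∣ + offset i

  level-path : ∀ {i} → i ≢ n → level i ≡ (k ∸ i) + (i ∸ k)
  level-path {i} i≢n = trans (cong₂ (λ p o → ∣ p - k ∣ + o) (position-path i≢n) (offset-path i≢n))
                             (trans (+-identityʳ _) (∣-∣≡∸+∸ i k))

  level-tip : s ≤ k → level n ≡ suc (k ∸ s)
  level-tip s≤k = trans (cong₂ (λ p o → ∣ p - k ∣ + o) position-tip offset-tip)
                        (trans (+-comm _ 1) (cong suc (m≤n⇒∣m-n∣≡n∸m s≤k)))

  dist-≤-levels : ∀ i j → spireDist i j ≤ level i + level j
  dist-≤-levels i j = begin
    spireDist i j                                                       ≤⟨ dist-≤-position i j ⟩
    ∣ position i - position j ∣ + offset i + offset j                   ≤⟨ +-monoˡ-≤ (offset j) (+-monoˡ-≤ (offset i) (∣-∣-via (position i) (position j) k k)) ⟩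
    ∣ position i - k ∣ + ∣ k - k ∣ + ∣ position j - k ∣ + offset i + offset j
      ≡⟨ cong (λ t → ∣ position i - k ∣ + t + ∣ position j - k ∣ + offset i + offset j) (∣n-n∣≡0 k) ⟩
    ∣ position i - k ∣ + 0 + ∣ position j - k ∣ + offset i + offset j  ≡⟨ regroup ∣ position i - k ∣ ∣ position j - k ∣ (offset i) (offset j) ⟩
    level i + level j                                                   ∎
    where
      open ≤-Reasoning
      regroup : ∀ a b e f → a + 0 + b + e + f ≡ a + e + (b + f)
      regroup = solve-∀

  level-zero : ∀ i → level i ≡ 0 → i ≡ k
  level-zero i ℓ≡0 = ∣m-n∣≡0⇒m≡n (trans (cong (λ t → ∣ t - k ∣) (sym (position-path i≢n))) (m+n≡0⇒m≡0 _ ℓ≡0))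
    where
      i≢n : i ≢ n
      i≢n = offset-zero⇒path (m+n≡0⇒n≡0 ∣ position i - k ∣ ℓ≡0)

module TwoCentres (m s k₁ : ℕ) (1≤s : 1 ≤ s) (s≤m : s ≤ m) where
  open SpireDistance m s 1≤s s≤m

  centre : Bool → ℕ
  centre true  = k₁
  centre false = suc k₁

  side : ℕ → Bool
  side i = position i <ᵇ suc k₁

  level : ℕ → ℕ
  level i = ∣ position i - centre (side i) ∣ + offset i

  centres-agree : ∀ b c → ∣ centre b - centre c ∣ + agree b c ≡ 1
  centres-agree true  true  = cong (_+ 1) (∣n-n∣≡0 k₁)
  centres-agree true  false = trans (+-identityʳ _) (∣n-1+n∣≡1 k₁)
  centres-agree false true  = trans (+-identityʳ _) (trans (∣-∣-comm (suc k₁) k₁) (∣n-1+n∣≡1 k₁))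
  centres-agree false false = cong (_+ 1) (∣n-n∣≡0 (suc k₁))

  dist-agree-≤ : ∀ i j → spireDist i j + agree (side i) (side j) ≤ 1 + level i + level j
  dist-agree-≤ i j = begin
    spireDist i j + a                                       ≤⟨ +-monoˡ-≤ a (dist-≤-position i j) ⟩
    ∣ pi - pj ∣ + offset i + offset j + a                   ≤⟨ +-monoˡ-≤ a (+-monoˡ-≤ (offset j) (+-monoˡ-≤ (offset i) (∣-∣-via pi pj ci cj))) ⟩
    ∣ pi - ci ∣ + ∣ ci - cj ∣ + ∣ pj - cj ∣ + offset i + offset j + a
      ≡⟨ regroup ∣ pi - ci ∣ ∣ ci - cj ∣ ∣ pj - cj ∣ (offset i) (offset j) a ⟩
    (∣ ci - cj ∣ + a) + level i + level j                   ≡⟨ cong (λ t → t + level i + level j) (centres-agree (side i) (side j)) ⟩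
    1 + level i + level j                                   ∎
    where
      open ≤-Reasoning
      pi pj : ℕ
      pi = position i
      pj = position j
      ci cj : ℕ
      ci = centre (side i)
      cj = centre (side j)
      a : ℕ
      a = agree (side i) (side j)
      regroup : ∀ x c y e f a → x + c + y + e + f + a ≡ c + a + (x + e) + (y + f)
      regroup = solve-∀

  level-zero : ∀ i → level i ≡ 0 → i ≡ k₁ ⊎ i ≡ suc k₁
  level-zero i ℓ≡0 =
    at-centre (side i) (∣m-n∣≡0⇒m≡n (trans (cong (λ t → ∣ t - centre (side i) ∣) (sym (position-path i≢n))) (m+n≡0⇒m≡0 _ ℓ≡0)))
    where
      i≢n : i ≢ n
      i≢n = offset-zero⇒path (m+n≡0⇒n≡0 ∣ position i - centre (side i) ∣ ℓ≡0)
      at-centre : ∀ b → i ≡ centre b → i ≡ k₁ ⊎ i ≡ suc k₁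
      at-centre true  = inj₁
      at-centre false = inj₂

  dist-≤-levels-off-centre : ∀ {k₂} → k₁ ≡ suc k₂ → ∀ {i j} → side i ≡ true → side j ≡ true →
                             position i ≢ k₁ → position j ≢ k₁ → spireDist i j + 2 ≤ level i + level j
  dist-≤-levels-off-centre {k₂} refl {i} {j} i-true j-true pi≢k₁ pj≢k₁ = begin
    spireDist i j + 2                                          ≤⟨ +-monoˡ-≤ 2 (dist-≤-position i j) ⟩
    ∣ pi - pj ∣ + offset i + offset j + 2                      ≤⟨ +-monoˡ-≤ 2 (+-monoˡ-≤ (offset j) (+-monoˡ-≤ (offset i) (∣-∣-via pi pj k₂ k₂))) ⟩
    ∣ pi - k₂ ∣ + ∣ k₂ - k₂ ∣ + ∣ pj - k₂ ∣ + offset i + offset j + 2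
      ≡⟨ cong (λ t → ∣ pi - k₂ ∣ + t + ∣ pj - k₂ ∣ + offset i + offset j + 2) (∣n-n∣≡0 k₂) ⟩
    ∣ pi - k₂ ∣ + 0 + ∣ pj - k₂ ∣ + offset i + offset j + 2    ≡⟨ regroup ∣ pi - k₂ ∣ ∣ pj - k₂ ∣ (offset i) (offset j) ⟩
    suc ∣ pi - k₂ ∣ + offset i + (suc ∣ pj - k₂ ∣ + offset j)
      ≡⟨ cong₂ (λ a b → a + offset i + (b + offset j)) (one-closer {i} i-true pi≢k₁) (one-closer {j} j-true pj≢k₁) ⟨
    level i + level j                                          ∎
    where
      open ≤-Reasoning
      pi pj : ℕ
      pi = position i
      pj = position j
      regroup : ∀ x y e f → x + 0 + y + e + f + 2 ≡ suc x + e + (suc y + f)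
      regroup = solve-∀
      one-closer : ∀ {v} → side v ≡ true → position v ≢ suc k₂ → ∣ position v - centre (side v) ∣ ≡ suc ∣ position v - k₂ ∣
      one-closer {v} v-true pv≢k₁ = begin-equality
        ∣ position v - centre (side v) ∣ ≡⟨ cong (λ b → ∣ position v - centre b ∣) v-true ⟩
        ∣ position v - suc k₂ ∣          ≡⟨ m≤n⇒∣m-n∣≡n∸m (m≤n⇒m≤1+n pv≤k₂) ⟩
        suc k₂ ∸ position v              ≡⟨ +-∸-assoc 1 pv≤k₂ ⟩
        suc (k₂ ∸ position v)            ≡⟨ cong suc (m≤n⇒∣m-n∣≡n∸m pv≤k₂) ⟨
        suc ∣ position v - k₂ ∣          ∎
        where
          pv≤k₂ : position v ≤ k₂
          pv≤k₂ = ≤-pred (≤∧≢⇒< (<ᵇ-true⇒≤ (position v) (suc k₂) v-true) pv≢k₁)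

  side-path : ∀ {i} → i ≢ n → side i ≡ (i <ᵇ suc k₁)
  side-path i≢n = cong (_<ᵇ suc k₁) (position-path i≢n)

  level-path : ∀ {i} → i ≢ n → level i ≡ (k₁ ∸ i) + (i ∸ suc k₁)
  level-path {i} i≢n = trans (cong₂ (λ p o → ∣ p - centre (p <ᵇ suc k₁) ∣ + o) (position-path i≢n) (offset-path i≢n))
                             (trans (+-identityʳ _) (by-region (i ≤? k₁)))
    where
      by-region : Dec (i ≤ k₁) → ∣ i - centre (i <ᵇ suc k₁) ∣ ≡ (k₁ ∸ i) + (i ∸ suc k₁)
      by-region (yes i≤k₁) rewrite <ᵇ-true i≤k₁ | m≤n⇒m∸n≡0 (m≤n⇒m≤1+n i≤k₁) = trans (m≤n⇒∣m-n∣≡n∸m i≤k₁) (sym (+-identityʳ _))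
      by-region (no  i≰k₁) rewrite <ᵇ-false (≰⇒> i≰k₁) | m≤n⇒m∸n≡0 (<⇒≤ (≰⇒> i≰k₁)) = m≤n⇒∣n-m∣≡n∸m (≰⇒> i≰k₁)

  side-tip : s ≤ k₁ → side n ≡ true
  side-tip s≤k₁ = trans (cong (_<ᵇ suc k₁) position-tip) (<ᵇ-true s≤k₁)

  level-tip : s ≤ k₁ → level n ≡ suc (k₁ ∸ s)
  level-tip s≤k₁ = begin
    ∣ position n - centre (side n) ∣ + offset n ≡⟨ cong₂ (λ p b → ∣ p - centre b ∣ + offset n) position-tip (side-tip s≤k₁) ⟩
    ∣ s - k₁ ∣ + offset n                      ≡⟨ cong₂ _+_ (m≤n⇒∣m-n∣≡n∸m s≤k₁) offset-tip ⟩
    (k₁ ∸ s) + 1                               ≡⟨ +-comm (k₁ ∸ s) 1 ⟩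
    suc (k₁ ∸ s)                               ∎
    where open ≡-Reasoning

-- Radio labelings of the spire graph

≤-span : ∀ {n} (c : Fin n → ℕ) (xs : List (Fin n)) {v} → v ∈ xs → c v ≤ foldr _⊔_ 0 (map c xs)
≤-span c (x ∷ xs) (here refl) = m≤m⊔n (c x) _
≤-span c (x ∷ xs) (there v∈)  = ≤-trans (≤-span c xs v∈) (m≤n⊔m (c x) _)

module RadioBound (m s : ℕ) (1≤s : 1 ≤ s) (s≤m : s ≤ m) {D : ℕ} (diameter : IsDiameter (SpireAdj (suc m) s) D)
                  (c : Fin (suc m) → ℕ) (radio : IsRadioLabeling (SpireAdj (suc m) s) D c) where
  open SpireDistance m s 1≤s s≤m public

  -- As diam ≥ m − 1, the labels of u and v differ by at least m − d(u, v).
  cost : Fin n → Fin n → ℕ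
  cost u v = m ∸ spireDist (label u) (label v)

  cost-≤ : ∀ {u v} → u ≢ v → c u ≤ c v → c u + cost u v ≤ c v
  cost-≤ {u} {v} u≢v cu≤cv = ≤-trans (+-monoʳ-≤ (c u) cost≤gap) (≤-reflexive (m+[n∸m]≡n cu≤cv))
    where
      cost≤gap : cost u v ≤ c v ∸ c u
      cost≤gap = m≤n+o⇒m∸n≤o m _ (subst (λ t → m ≤ spireDist (label u) (label v) + t)
                                         (trans (∣-∣-comm (c u) (c v)) (m≤n⇒∣n-m∣≡n∸m cu≤cv)) (radio-≥ diameter radio u≢v))

  order : DecTotalOrder _ _ _
  order = On.decTotalOrder ≤-decTotalOrder c

  open Sort order using (sort; sort-↭; sort-↗)

  ordering : List (Fin n)
  ordering = sort (allFin n)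

  ordering-nonempty : ∃₂ λ x rest → ordering ≡ x ∷ rest
  ordering-nonempty with ordering | ↭-length (sort-↭ (allFin n))
  ... | x ∷ rest | _ = x , rest , refl

  x₀ : Fin n
  x₀ = proj₁ ordering-nonempty

  rest : List (Fin n)
  rest = proj₁ (proj₂ ordering-nonempty)

  ordering≡ : ordering ≡ x₀ ∷ rest
  ordering≡ = proj₂ (proj₂ ordering-nonempty)

  ordering-↭ : x₀ ∷ rest ↭ allFin n
  ordering-↭ = subst (_↭ allFin n) ordering≡ (sort-↭ (allFin n))

  ordering-sorted : AllPairs (λ a b → c a ≤ c b) (x₀ ∷ rest)
  ordering-sorted = subst (AllPairs _) ordering≡ (Sorted⇒AllPairs (DecTotalOrder.totalOrder order) (sort-↗ (allFin n)))

  ordering-unique : Unique (x₀ ∷ rest)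
  ordering-unique = Perm.Unique-resp-↭ (setoid (Fin n)) (↭⇒↭ₛ (↭-sym ordering-↭)) (allFin⁺ n)

  ordering-complete : ∀ v → v ∈ x₀ ∷ rest
  ordering-complete v = ∈-resp-↭ (↭-sym ordering-↭) (∈-allFin v)

  ordering-sum : ∀ g → sum (map (g ∘ label) (x₀ ∷ rest)) ≡ sumTo g n
  ordering-sum g = trans (sum-↭ (map⁺ (g ∘ label) ordering-↭)) (sum-labels n g)

  length-rest : length rest ≡ m
  length-rest = suc-injective (trans (↭-length ordering-↭) (length-tabulate {n = n} (λ v → v)))

  module Levelled (lev : ℕ → ℕ) (A : ℕ) where
    ℓ : Fin n → ℕ
    ℓ v = lev (label v)

    open Budget cost ℓ A public

    cost-≥ : ∀ u v b → A + b + spireDist (label u) (label v) ≤ m + ℓ u + ℓ v → A + b ≤ cost u v + ℓ u + ℓ v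
    cost-≥ u v b h = +-cancelʳ-≤ d (A + b) _ (begin
      A + b + d                   ≤⟨ h ⟩
      m + ℓ u + ℓ v               ≤⟨ +-monoˡ-≤ (ℓ v) (+-monoˡ-≤ (ℓ u) (m≤n+m∸n m d)) ⟩
      d + (m ∸ d) + ℓ u + ℓ v     ≡⟨ regroup d (m ∸ d) (ℓ u) (ℓ v) ⟩
      (m ∸ d) + ℓ u + ℓ v + d     ∎)
      where
        open ≤-Reasoning
        d : ℕ
        d = spireDist (label u) (label v)
        regroup : ∀ d e a b → d + e + a + b ≡ e + a + b + d
        regroup = solve-∀

    span-≥ : ∀ {g k R} → Surplus x₀ rest g → 2 * sumTo lev n + k ≡ R → m * A + g + 1 + k ≤ span c + R
    span-≥ {g} {k} {R} (total , chain , h) level-sum = begin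
      m * A + g + 1 + k                        ≡⟨ cong (λ t → t * A + g + 1 + k) (sym length-rest) ⟩
      length rest * A + g + 1 + k              ≤⟨ +-monoˡ-≤ k (+-mono-≤ h (proj₁ radio x₀)) ⟩
      total + 2 * Σℓ (x₀ ∷ rest) + c x₀ + k   ≡⟨ regroup total (2 * Σℓ (x₀ ∷ rest)) (c x₀) k ⟩
      c x₀ + total + (2 * Σℓ (x₀ ∷ rest) + k) ≤⟨ +-monoˡ-≤ _ (chain-≤ cost c cost-≤ chain ordering-sorted ordering-unique) ⟩
      c (lastOf x₀ rest) + (2 * Σℓ (x₀ ∷ rest) + k) ≤⟨ +-monoˡ-≤ _ (≤-span c (allFin n) (∈-allFin _)) ⟩
      span c + (2 * Σℓ (x₀ ∷ rest) + k)       ≡⟨ cong (λ t → span c + (2 * t + k)) (ordering-sum lev) ⟩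
      span c + (2 * sumTo lev n + k)           ≡⟨ cong (span c +_) level-sum ⟩
      span c + R                               ∎
      where
        open ≤-Reasoning
        regroup : ∀ t l x k → t + l + x + k ≡ x + t + (l + k)
        regroup = solve-∀

module OneCentreBound (m s k r : ℕ) (1≤s : 1 ≤ s) (s≤k : s ≤ k) (m≡k+r : m ≡ k + r)
                      {D : ℕ} (diameter : IsDiameter (SpireAdj (suc m) s) D)
                      (c : Fin (suc m) → ℕ) (radio : IsRadioLabeling (SpireAdj (suc m) s) D c) where

  k≤m : k ≤ m
  k≤m = ≤-trans (m≤m+n k r) (≤-reflexive (sym m≡k+r))

  open RadioBound m s 1≤s (≤-trans s≤k k≤m) diameter c radio
  open OneCentre m s k 1≤s (≤-trans s≤k k≤m)
  open Levelled level m

  centre : Σ (Fin n) λ v → label v ≡ k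
  centre = vertexAt k (≤-trans 1≤s s≤k) (m≤n⇒m≤1+n k≤m)

  only-centre : ∀ u → ℓ u ≡ 0 → u ≡ proj₁ centre
  only-centre u ℓu≡0 = label-injective (trans (level-zero (label u) ℓu≡0) (sym (proj₂ centre)))

  surplus : Surplus x₀ rest 1
  surplus = nonempty rest length-rest ordering-unique
    where
      within-levels : ∀ u v → m + 0 + spireDist (label u) (label v) ≤ m + ℓ u + ℓ v
      within-levels u v = begin
        m + 0 + spireDist (label u) (label v) ≡⟨ cong (_+ spireDist (label u) (label v)) (+-identityʳ m) ⟩
        m + spireDist (label u) (label v)     ≤⟨ +-monoʳ-≤ m (dist-≤-levels (label u) (label v)) ⟩
        m + (ℓ u + ℓ v)                       ≡⟨ +-assoc m (ℓ u) (ℓ v) ⟨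
        m + ℓ u + ℓ v                         ∎
        where open ≤-Reasoning
      nonempty : ∀ ys → length ys ≡ m → Unique (x₀ ∷ ys) → Surplus x₀ ys 1
      nonempty []       0≡m _ = ⊥-elim (<⇒≢ (≤-trans (≤-trans 1≤s s≤k) k≤m) 0≡m)
      nonempty (y ∷ ys) _   u = surplus-one-centre (proj₁ centre) only-centre (λ {u} {v} _ → cost-≥ u v 0 (within-levels u v)) x₀ y ys u

  sum-levels : 2 * sumTo level n + k ≡ k * k + r * suc r + 2 * suc (k ∸ s)
  sum-levels = begin
    2 * sumTo level n + k                                              ≡⟨ cong (λ t → 2 * t + k) (sumTo-snoc level m) ⟩
    2 * (sumTo level m + level n) + k                                  ≡⟨ cong₂ (λ a b → 2 * (a + b) + k) path-sum (level-tip s≤k) ⟩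
    2 * (sumTo (k ∸_) (k + r) + sumTo (_∸ k) (k + r) + suc (k ∸ s)) + k ≡⟨ regroup (sumTo (k ∸_) (k + r)) (sumTo (_∸ k) (k + r)) (suc (k ∸ s)) k ⟩
    (2 * sumTo (k ∸_) (k + r) + k) + 2 * sumTo (_∸ k) (k + r) + 2 * suc (k ∸ s)
      ≡⟨ cong₂ (λ a b → a + b + 2 * suc (k ∸ s)) (double-sumTo-∸ˡ k r) (double-sumTo-∸ʳ k r) ⟩
    k * k + r * suc r + 2 * suc (k ∸ s)                                ∎
    where
      open ≡-Reasoning
      regroup : ∀ a b t k → 2 * (a + b + t) + k ≡ 2 * a + k + 2 * b + 2 * t
      regroup = solve-∀
      path-sum : sumTo level m ≡ sumTo (k ∸_) (k + r) + sumTo (_∸ k) (k + r)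
      path-sum = begin
        sumTo level m                                   ≡⟨ sumTo-cong m (λ i _ i≤m → level-path (path-≢n i≤m)) ⟩
        sumTo (λ i → (k ∸ i) + (i ∸ k)) m               ≡⟨ sumTo-+ (k ∸_) (_∸ k) m ⟩
        sumTo (k ∸_) m + sumTo (_∸ k) m                 ≡⟨ cong (λ t → sumTo (k ∸_) t + sumTo (_∸ k) t) m≡k+r ⟩
        sumTo (k ∸_) (k + r) + sumTo (_∸ k) (k + r)     ∎

  one-centre-span : m * m + 1 + 1 + k ≤ span c + (k * k + r * suc r + 2 * suc (k ∸ s))
  one-centre-span = span-≥ surplus sum-levels

module TwoCentreBound (m s k₁ : ℕ) (2≤s : 2 ≤ s) (s≤k₁ : s ≤ k₁) (m≡ : m ≡ k₁ + suc k₁)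
                      {D : ℕ} (diameter : IsDiameter (SpireAdj (suc m) s) D)
                      (c : Fin (suc m) → ℕ) (radio : IsRadioLabeling (SpireAdj (suc m) s) D c) where

  1≤s : 1 ≤ s
  1≤s = ≤-trans (s≤s z≤n) 2≤s

  k₁<m : k₁ < m
  k₁<m = ≤-trans (m≤n+m (suc k₁) k₁) (≤-reflexive (sym m≡))

  s≤m : s ≤ m
  s≤m = ≤-trans s≤k₁ (<⇒≤ k₁<m)

  open RadioBound m s 1≤s s≤m diameter c radio
  open TwoCentres m s k₁ 1≤s s≤m
  open Levelled level (m ∸ 1)

  m∸1≡ : m ∸ 1 ≡ k₁ + k₁
  m∸1≡ = trans (cong (_∸ 1) m≡) (cong (_∸ 1) (+-suc k₁ k₁))

  sideV : Fin n → Bool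
  sideV v = side (label v)

  demand+1≤m : m ∸ 1 + 1 ≤ m
  demand+1≤m = ≤-reflexive (trans (cong (_+ 1) m∸1≡) (trans (+-comm (k₁ + k₁) 1) (trans (sym (+-suc k₁ k₁)) (sym m≡))))

  agree-≤ : ∀ {u v} → u ≢ v → m ∸ 1 + agree (sideV u) (sideV v) ≤ cost u v + ℓ u + ℓ v
  agree-≤ {u} {v} _ = cost-≥ u v _ (begin
    m ∸ 1 + a + d             ≡⟨ +-assoc (m ∸ 1) a d ⟩
    m ∸ 1 + (a + d)           ≡⟨ cong (m ∸ 1 +_) (+-comm a d) ⟩
    m ∸ 1 + (d + a)           ≤⟨ +-monoʳ-≤ (m ∸ 1) (dist-agree-≤ (label u) (label v)) ⟩
    m ∸ 1 + (1 + ℓ u + ℓ v)   ≡⟨ regroup (m ∸ 1) (ℓ u) (ℓ v) ⟩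
    m ∸ 1 + 1 + ℓ u + ℓ v     ≤⟨ +-monoˡ-≤ (ℓ v) (+-monoˡ-≤ (ℓ u) demand+1≤m) ⟩
    m + ℓ u + ℓ v             ∎)
    where
      open ≤-Reasoning
      a : ℕ
      a = agree (sideV u) (sideV v)
      d : ℕ
      d = spireDist (label u) (label v)
      regroup : ∀ A x y → A + (1 + x + y) ≡ A + 1 + x + y
      regroup = solve-∀

  open TwoSides sideV agree-≤

  vertex : ∀ l → 1 ≤ l → l ≤ m → Σ (Fin n) λ v → label v ≡ l
  vertex l 1≤l l≤m = vertexAt l 1≤l (m≤n⇒m≤1+n l≤m)

  level-at : ∀ {l} (v : Σ (Fin n) λ v → label v ≡ l) → l ≤ m → ℓ (proj₁ v) ≡ (k₁ ∸ l) + (l ∸ suc k₁)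
  level-at (v , refl) l≤m = level-path (path-≢n l≤m)

  side-at : ∀ {l} (v : Σ (Fin n) λ v → label v ≡ l) → l ≤ m → sideV (proj₁ v) ≡ (l <ᵇ suc k₁)
  side-at (v , refl) l≤m = side-path (path-≢n l≤m)

  R-at : Σ (Fin n) λ v → label v ≡ m
  R-at = vertex m (≤-trans 1≤s s≤m) ≤-refl

  R : Fin n
  R = proj₁ R-at

  R-false : sideV R ≡ false
  R-false = trans (side-at R-at ≤-refl) (<ᵇ-false k₁<m)

  ℓR≡k₁ : ℓ R ≡ k₁
  ℓR≡k₁ = trans (level-at R-at ≤-refl)
                (cong₂ _+_ (m≤n⇒m∸n≡0 (<⇒≤ k₁<m)) (trans (cong (_∸ suc k₁) m≡) (m+n∸n≡m k₁ (suc k₁))))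

  sum-levels : 2 * sumTo level n + k₁ ≡ k₁ * k₁ + k₁ * suc k₁ + 2 * suc (k₁ ∸ s)
  sum-levels = begin
    2 * sumTo level n + k₁                                   ≡⟨ cong (λ t → 2 * t + k₁) (sumTo-snoc level m) ⟩
    2 * (sumTo level m + level n) + k₁                       ≡⟨ cong₂ (λ a b → 2 * (a + b) + k₁) path-sum (level-tip s≤k₁) ⟩
    2 * (sumTo (k₁ ∸_) m + sumTo (_∸ suc k₁) m + suc (k₁ ∸ s)) + k₁
      ≡⟨ regroup (sumTo (k₁ ∸_) m) (sumTo (_∸ suc k₁) m) (suc (k₁ ∸ s)) k₁ ⟩
    (2 * sumTo (k₁ ∸_) m + k₁) + 2 * sumTo (_∸ suc k₁) m + 2 * suc (k₁ ∸ s)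
      ≡⟨ cong₂ (λ a b → a + b + 2 * suc (k₁ ∸ s)) left right ⟩
    k₁ * k₁ + k₁ * suc k₁ + 2 * suc (k₁ ∸ s)                 ∎
    where
      open ≡-Reasoning
      regroup : ∀ a b t k → 2 * (a + b + t) + k ≡ 2 * a + k + 2 * b + 2 * t
      regroup = solve-∀
      path-sum : sumTo level m ≡ sumTo (k₁ ∸_) m + sumTo (_∸ suc k₁) m
      path-sum = trans (sumTo-cong m (λ i _ i≤m → level-path (path-≢n i≤m))) (sumTo-+ (k₁ ∸_) (_∸ suc k₁) m)
      left : 2 * sumTo (k₁ ∸_) m + k₁ ≡ k₁ * k₁
      left = trans (cong (λ t → 2 * sumTo (k₁ ∸_) t + k₁) m≡) (double-sumTo-∸ˡ k₁ (suc k₁))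
      right : 2 * sumTo (_∸ suc k₁) m ≡ k₁ * suc k₁
      right = trans (cong (λ t → 2 * sumTo (_∸ suc k₁) t) (trans m≡ (+-comm k₁ (suc k₁)))) (double-sumTo-∸ʳ (suc k₁) k₁)

  demand≡2ℓR : m ∸ 1 ≡ 2 * ℓ R
  demand≡2ℓR = trans m∸1≡ (sym (trans (cong (2 *_) ℓR≡k₁) (cong (k₁ +_) (+-identityʳ k₁))))

  heavy-span : m * (m ∸ 1) + 1 + 1 + k₁ ≤ span c + (k₁ * k₁ + k₁ * suc k₁ + 2 * suc (k₁ ∸ s))
  heavy-span = span-≥ (surplus-heavy R R-false (≤-reflexive demand≡2ℓR)
                                     (≤-trans 2≤s (≤-trans s≤k₁ (≤-reflexive (sym ℓR≡k₁))))
                                     x₀ rest ordering-unique (ordering-complete R)) sum-levels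

  count-true : countTrue (x₀ ∷ rest) ≡ suc k₁
  count-true = begin
    countTrue (x₀ ∷ rest)                                      ≡⟨ ordering-sum (λ i → indicator (side i)) ⟩
    sumTo (λ i → indicator (side i)) n                         ≡⟨ sumTo-snoc (λ i → indicator (side i)) m ⟩
    sumTo (λ i → indicator (side i)) m + indicator (side n)    ≡⟨ cong₂ _+_ path-count (cong indicator (side-tip s≤k₁)) ⟩
    k₁ + 1                                                     ≡⟨ +-comm k₁ 1 ⟩
    suc k₁                                                     ∎
    where
      open ≡-Reasoning
      path-count : sumTo (λ i → indicator (side i)) m ≡ k₁
      path-count = begin
        sumTo (λ i → indicator (side i)) m                 ≡⟨ sumTo-cong m (λ i _ i≤m → cong indicator (side-path (path-≢n i≤m))) ⟩
        sumTo (λ i → indicator (i <ᵇ suc k₁)) m            ≡⟨ cong (sumTo (λ i → indicator (i <ᵇ suc k₁))) m≡ ⟩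
        sumTo (λ i → indicator (i <ᵇ suc k₁)) (k₁ + suc k₁) ≡⟨ sumTo-<ᵇ k₁ (suc k₁) ⟩
        k₁                                                 ∎

  counts-balanced : countTrue (x₀ ∷ rest) ≡ countFalse (x₀ ∷ rest)
  counts-balanced = trans count-true (sym (+-cancelˡ-≡ (suc k₁) _ _ (begin
    suc k₁ + countFalse (x₀ ∷ rest)                      ≡⟨ cong (_+ countFalse (x₀ ∷ rest)) count-true ⟨
    countTrue (x₀ ∷ rest) + countFalse (x₀ ∷ rest)       ≡⟨ count-total (x₀ ∷ rest) ⟩
    suc (length rest)                                    ≡⟨ cong suc (trans length-rest m≡) ⟩
    suc (k₁ + suc k₁)                                    ∎)))
    where open ≡-Reasoning

  module OffCentre (k₂ : ℕ) (k₁≡ : k₁ ≡ suc k₂) (s≤k₂ : s ≤ k₂) where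

    1≤k₁ : 1 ≤ k₁
    1≤k₁ = ≤-trans 1≤s s≤k₁

    w-at : Σ (Fin n) λ v → label v ≡ k₁
    w-at = vertex k₁ 1≤k₁ (<⇒≤ k₁<m)

    w'-at : Σ (Fin n) λ v → label v ≡ suc k₁
    w'-at = vertex (suc k₁) (s≤s z≤n) k₁<m

    q : ℕ
    q = suc k₁ + k₂

    q<m : q < m
    q<m = ≤-reflexive (trans (cong (λ t → suc (suc t + k₂)) k₁≡) (trans (regroup k₂) (trans (cong (λ t → t + suc t) (sym k₁≡)) (sym m≡))))
      where
        regroup : ∀ k → suc (suc (suc k) + k) ≡ suc k + suc (suc k)
        regroup = solve-∀

    k₁<q : k₁ < q
    k₁<q = m≤m+n (suc k₁) k₂

    Q-at : Σ (Fin n) λ v → label v ≡ q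
    Q-at = vertex q (s≤s z≤n) (<⇒≤ q<m)

    w : Fin n
    w = proj₁ w-at

    w' : Fin n
    w' = proj₁ w'-at

    Q : Fin n
    Q = proj₁ Q-at

    w-true : sideV w ≡ true
    w-true = trans (side-at w-at (<⇒≤ k₁<m)) (<ᵇ-true (≤-refl {k₁}))

    w'-false : sideV w' ≡ false
    w'-false = trans (side-at w'-at k₁<m) (<ᵇ-false (≤-refl {suc k₁}))

    Q-false : sideV Q ≡ false
    Q-false = trans (side-at Q-at (<⇒≤ q<m)) (<ᵇ-false k₁<q)

    ℓQ≡k₂ : ℓ Q ≡ k₂
    ℓQ≡k₂ = trans (level-at Q-at (<⇒≤ q<m)) (cong₂ _+_ (m≤n⇒m∸n≡0 (<⇒≤ k₁<q)) (m+n∸m≡n (suc k₁) k₂))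

    Q≢R : Q ≢ R
    Q≢R Q≡R = <⇒≢ q<m (trans (sym (proj₂ Q-at)) (trans (cong label Q≡R) (proj₂ R-at)))

    level-zero-at-centres : ∀ u → ℓ u ≡ 0 → u ≡ w ⊎ u ≡ w'
    level-zero-at-centres u ℓu≡0 with level-zero (label u) ℓu≡0
    ... | inj₁ u≡k₁  = inj₁ (label-injective (trans u≡k₁ (sym (proj₂ w-at))))
    ... | inj₂ u≡1+k₁ = inj₂ (label-injective (trans u≡1+k₁ (sym (proj₂ w'-at))))

    demand≡2+2ℓQ : m ∸ 1 ≡ 2 + 2 * ℓ Q
    demand≡2+2ℓQ = trans m∸1≡ (trans (cong (λ t → t + t) k₁≡) (trans (regroup k₂) (cong (λ t → 2 + 2 * t) (sym ℓQ≡k₂))))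
      where
        regroup : ∀ k → suc k + suc k ≡ 2 + 2 * k
        regroup = solve-∀

    s≢k₁ : s ≢ k₁
    s≢k₁ = <⇒≢ (≤-trans (s≤s s≤k₂) (≤-reflexive (sym k₁≡)))

    off-centre-≤ : ∀ {a b} → a ≢ b → sideV a ≡ true → sideV b ≡ true → a ≢ w → b ≢ w → m ∸ 1 + 3 ≤ cost a b + ℓ a + ℓ b
    off-centre-≤ {a} {b} _ a-true b-true a≢w b≢w = cost-≥ a b 3 (begin
      m ∸ 1 + 3 + d          ≡⟨ regroup (m ∸ 1) d ⟩
      m ∸ 1 + 1 + (d + 2)    ≤⟨ +-mono-≤ demand+1≤m (dist-≤-levels-off-centre k₁≡ a-true b-true (off-w a≢w) (off-w b≢w)) ⟩
      m + (ℓ a + ℓ b)        ≡⟨ +-assoc m (ℓ a) (ℓ b) ⟨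
      m + ℓ a + ℓ b          ∎)
      where
        open ≤-Reasoning
        d : ℕ
        d = spireDist (label a) (label b)
        regroup : ∀ A d → A + 3 + d ≡ A + 1 + (d + 2)
        regroup = solve-∀
        off-w : ∀ {v} → v ≢ w → position (label v) ≢ k₁
        off-w v≢w = position-≢ s≢k₁ (λ v≡k₁ → v≢w (label-injective (trans v≡k₁ (sym (proj₂ w-at)))))

    open Balanced _≟ᶠ_ w w' w-true w'-false level-zero-at-centres R Q R-false Q-false Q≢R
                  (≤-reflexive demand≡2ℓR) (≤-trans 2≤s (≤-trans s≤k₁ (≤-reflexive (sym ℓR≡k₁))))
                  (≤-reflexive demand≡2+2ℓQ) (≤-trans (≤-trans 1≤s s≤k₂) (≤-reflexive (sym ℓQ≡k₂)))
                  off-centre-≤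

    balanced-span : m * (m ∸ 1) + 2 + 1 + k₁ ≤ span c + (k₁ * k₁ + k₁ * suc k₁ + 2 * suc (k₁ ∸ s))
    balanced-span = span-≥ (surplus-balanced x₀ rest ordering-unique (ordering-complete R) (ordering-complete Q) counts-balanced) sum-levels

half-≤ : ∀ {s n k} → s ≤ n / 2 → n ≡ 2 * k + 1 → s ≤ k
half-≤ {s} {n} {k} s≤n/2 refl =
  ≤-pred (*-cancelʳ-< 2 s (suc k) (≤-trans (s≤s (≤-trans (*-monoˡ-≤ 2 s≤n/2) (m/n*n≤m n 2))) (≤-reflexive (regroup k))))
  where
    regroup : ∀ k → suc (2 * k + 1) ≡ suc k * 2
    regroup = solve-∀

odd-arithmetic : ∀ {m s k d σ} → k ≡ s + d → m ≡ k + k →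
                 m * m + 1 + 1 + k ≤ σ + (k * k + k * suc k + 2 * suc d) →
                 2 * k * k + 2 * s ≤ 2 * k + σ
odd-arithmetic {s = s} {d = d} {σ} refl refl bound = ≤-rebalance bound (identity s d σ)
  where
    identity : ∀ s d σ → let k = s + d in
      2 * k * k + 2 * s + (σ + (k * k + k * suc k + 2 * suc d)) ≡ 2 * k + σ + ((k + k) * (k + k) + 1 + 1 + k)
    identity = solve-∀

equal-arithmetic : ∀ {m r d σ} → m ≡ suc r + r → d ≡ 0 →
                   m * m + 1 + 1 + suc r ≤ σ + (suc r * suc r + r * suc r + 2 * suc d) →
                   2 * suc r * suc r + 1 ≤ 2 * suc r + σ
equal-arithmetic {r = r} {σ = σ} refl refl bound = ≤-rebalance bound (identity r σ)
  where
    identity : ∀ r σ → let k = suc r in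
      2 * k * k + 1 + (σ + (k * k + r * k + 2 * 1)) ≡ 2 * k + σ + ((k + r) * (k + r) + 1 + 1 + k)
    identity = solve-∀

heavy-arithmetic : ∀ {m A k₁ d σ} → m ≡ suc (k₁ + k₁) → A ≡ k₁ + k₁ → d ≡ 0 →
                   m * A + 1 + 1 + k₁ ≤ σ + (k₁ * k₁ + k₁ * suc k₁ + 2 * suc d) →
                   2 * suc k₁ * suc k₁ ≤ 2 * suc k₁ + σ
heavy-arithmetic {k₁ = k₁} {σ = σ} refl refl refl bound = ≤-rebalance bound (identity k₁ σ)
  where
    identity : ∀ k₁ σ →
      2 * suc k₁ * suc k₁ + (σ + (k₁ * k₁ + k₁ * suc k₁ + 2 * 1)) ≡ 2 * suc k₁ + σ + (suc (k₁ + k₁) * (k₁ + k₁) + 1 + 1 + k₁)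
    identity = solve-∀

balanced-arithmetic : ∀ {m A k₁ s d σ} → k₁ ≡ s + d → m ≡ suc (k₁ + k₁) → A ≡ k₁ + k₁ →
                      m * A + 2 + 1 + k₁ ≤ σ + (k₁ * k₁ + k₁ * suc k₁ + 2 * suc d) →
                      2 * suc k₁ * suc k₁ + 2 * s + 3 ≤ 4 * suc k₁ + σ
balanced-arithmetic {s = s} {d} {σ} refl refl refl bound = ≤-rebalance bound (identity s d σ)
  where
    identity : ∀ s d σ → let k₁ = s + d in
      2 * suc k₁ * suc k₁ + 2 * s + 3 + (σ + (k₁ * k₁ + k₁ * suc k₁ + 2 * suc d))
        ≡ 4 * suc k₁ + σ + (suc (k₁ + k₁) * (k₁ + k₁) + 2 + 1 + k₁)
    identity = solve-∀

double-pred : ∀ {m k} → suc m ≡ 2 * suc k → m ≡ k + suc k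
double-pred {k = k} eq = trans (suc-injective eq) (cong (k +_) (+-identityʳ (suc k)))

double-odd : ∀ {m k} → suc m ≡ 2 * k + 1 → m ≡ k + k
double-odd {k = k} eq = trans (suc-injective (trans eq (+-comm (2 * k) 1))) (cong (k +_) (+-identityʳ k))

module SpanBounds (m s : ℕ) (2≤s : 2 ≤ s) {D : ℕ} (diameter : IsDiameter (SpireAdj (suc m) s) D)
                  (c : Fin (suc m) → ℕ) (radio : IsRadioLabeling (SpireAdj (suc m) s) D c) where

  1≤s : 1 ≤ s
  1≤s = ≤-trans (s≤s z≤n) 2≤s

  s≰0 : s ≤ 0 → ⊥
  s≰0 s≤0 with ≤-trans 2≤s s≤0
  ... | ()

  span-far-from-centre : (k : ℕ) → suc m ≡ 2 * k → s ≤ k ∸ 2 → 2 * k * k + 2 * s + 3 ∸ 4 * k ≤ span c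
  span-far-from-centre zero           _    s≤0  = ⊥-elim (s≰0 s≤0)
  span-far-from-centre (suc zero)     _    s≤0  = ⊥-elim (s≰0 s≤0)
  span-far-from-centre (suc (suc k₂)) n≡2k s≤k₂ = m≤n+o⇒m∸n≤o _ (4 * suc (suc k₂))
      (balanced-arithmetic (sym (m+[n∸m]≡n s≤k₁)) (trans m≡ (+-suc k₁ k₁)) m∸1≡ balanced-span)
    where
      k₁ : ℕ
      k₁ = suc k₂
      s≤k₁ : s ≤ k₁
      s≤k₁ = ≤-trans s≤k₂ (n≤1+n k₂)
      m≡ : m ≡ k₁ + suc k₁
      m≡ = double-pred {k = k₁} n≡2k
      open TwoCentreBound m s k₁ 2≤s s≤k₁ m≡ diameter c radio
      open OffCentre k₂ refl s≤k₂

  span-next-to-centre : (k : ℕ) → suc m ≡ 2 * k → s ≡ k ∸ 1 → 2 * k * k ∸ 2 * k ≤ span c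
  span-next-to-centre zero     _    s≡0  = ⊥-elim (s≰0 (≤-reflexive s≡0))
  span-next-to-centre (suc k₁) n≡2k refl = m≤n+o⇒m∸n≤o _ (2 * suc s)
      (heavy-arithmetic (trans m≡ (+-suc s s)) m∸1≡ (n∸n≡0 s) heavy-span)
    where
      m≡ : m ≡ s + suc s
      m≡ = double-pred {k = s} n≡2k
      open TwoCentreBound m s s 2≤s ≤-refl m≡ diameter c radio

  span-at-centre : (k : ℕ) → suc m ≡ 2 * k → s ≡ k → 2 * k * k + 1 ∸ 2 * k ≤ span c
  span-at-centre zero    _    s≡0 = ⊥-elim (s≰0 (≤-reflexive s≡0))
  span-at-centre (suc r) n≡2k s≡k = m≤n+o⇒m∸n≤o _ (2 * suc r) (equal-arithmetic m≡ k∸s≡0 one-centre-span)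
    where
      m≡ : m ≡ suc r + r
      m≡ = trans (double-pred {k = r} n≡2k) (+-suc r r)
      k∸s≡0 : suc r ∸ s ≡ 0
      k∸s≡0 = trans (cong (suc r ∸_) s≡k) (n∸n≡0 (suc r))
      open OneCentreBound m s (suc r) r 1≤s (≤-reflexive s≡k) m≡ diameter c radio

  span-odd : s ≤ suc m / 2 → (k : ℕ) → suc m ≡ 2 * k + 1 → 2 * k * k + 2 * s ∸ 2 * k ≤ span c
  span-odd s≤n/2 k n≡2k+1 = m≤n+o⇒m∸n≤o _ (2 * k) (odd-arithmetic (sym (m+[n∸m]≡n s≤k)) m≡ one-centre-span)
    where
      s≤k : s ≤ k
      s≤k = half-≤ s≤n/2 n≡2k+1
      m≡ : m ≡ k + k
      m≡ = double-odd {k = k} n≡2k+1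
      open OneCentreBound m s k k 1≤s s≤k m≡ diameter c radio

mainTheorem3 : (n s : ℕ) → 4 ≤ n → 2 ≤ s → s ≤ n / 2 →
    (D : ℕ) → IsDiameter (SpireAdj n s) D →
    (c : Fin n → ℕ) → IsRadioLabeling (SpireAdj n s) D c →
      ((k : ℕ) → n ≡ 2 * k → s ≤ k ∸ 2 → 2 * k * k + 2 * s + 3 ∸ 4 * k ≤ span c)
      × ((k : ℕ) → n ≡ 2 * k → s ≡ k ∸ 1 → 2 * k * k ∸ 2 * k ≤ span c)
      × ((k : ℕ) → n ≡ 2 * k → s ≡ k → 2 * k * k + 1 ∸ 2 * k ≤ span c)
      × ((k : ℕ) → n ≡ 2 * k + 1 → 2 * k * k + 2 * s ∸ 2 * k ≤ span c)
mainTheorem3 zero    s ()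
mainTheorem3 (suc m) s _ 2≤s s≤n/2 D diameter c radio =
  span-far-from-centre , span-next-to-centre , span-at-centre , span-odd s≤n/2
  where open SpanBounds m s 2≤s diameter c radio
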